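{- Let $G$ be a disconnected finite simple graph of order $n$ such that every component has order divisible by $4$ and every bipartite component has both color classes of even order. Then $s_g(G)=n$.
   Context: For an Abelian group $\mathcal{G}$ and an edge labeling $f:E(G)\to\mathcal{G}$, the weighted degree of a vertex $v$ is $w(v)=\sum_{u\in N(v)} f(uv)$ (sum in $\mathcal{G}$); $f$ is $\mathcal{G}$-irregular if all weighted degrees are pairwise distinct. The group irregularity strength $s_g(G)$ is the smallest integer $s$ such that for every Abelian group $\mathcal{G}$ of order $s$ there exists a $\mathcal{G}$-irregular labeling of $G$. -}

module Defs where

open import Level using (0ℓ)
open import Data.Bool using (Bool; true; false; if_then_else_; not)
open import Data.Nat using (ℕ; _≤_)
open import Data.Nat.Divisibility using (_∣_)
open import Data.Fin using (Fin)
open import Data.List using (List; foldr; allFin; length; filterᵇ)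
open import Data.List.Membership.Propositional using (_∈_)
open import Data.List.Relation.Unary.Unique.Propositional using (Unique)
open import Data.Product using (Σ; ∃; _×_; _,_)
open import Relation.Binary.PropositionalEquality using (_≡_; _≢_)
open import Relation.Nullary using (¬_)
open import Function.Bundles using (_⇔_)
open import Algebra.Bundles using (AbelianGroup)

record Graph (n : ℕ) : Set where
  field
    adj    : Fin n → Fin n → Bool
    sym    : ∀ u v → adj u v ≡ adj v u
    irrefl : ∀ u → adj u u ≡ false
open Graph public

Adj : ∀ {n} → Graph n → Fin n → Fin n → Set
Adj G u v = adj G u v ≡ true

data Reach {n : ℕ} (G : Graph n) : Fin n → Fin n → Set where
  here : ∀ {u} → Reach G u u
  step : ∀ {u v w} → Reach G u v → Adj G v w → Reach G u w

Disconnected : ∀ {n} → Graph n → Set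
Disconnected G = ∃ λ u → ∃ λ v → ¬ Reach G u v

ComponentList : ∀ {n} → Graph n → Fin n → List (Fin n) → Set
ComponentList G v L = Unique L × (∀ u → (u ∈ L) ⇔ Reach G v u)

Proper2ColouringOn : ∀ {n} → Graph n → List (Fin n) → (Fin n → Bool) → Set
Proper2ColouringOn G L c = ∀ u w → u ∈ L → w ∈ L → Adj G u w → c u ≢ c w

ComponentHyp : ∀ {n} → Graph n → Set
ComponentHyp G = ∀ v L → ComponentList G v L →
    (4 ∣ length L)
  × (∀ c → Proper2ColouringOn G L c →
        2 ∣ length (filterᵇ c L) × 2 ∣ length (filterᵇ (λ u → not (c u)) L))

module _ (A : AbelianGroup 0ℓ 0ℓ) where
  open AbelianGroup A renaming (Carrier to C)

  HasOrder : ℕ → Set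
  HasOrder s = Σ (Fin s → C) λ e →
    (∀ i j → e i ≈ e j → i ≡ j) × (∀ x → ∃ λ i → e i ≈ x)

  -- Edge labelings: a label f u v for each unordered pair {u,v} (symmetric).
  Labeling : ∀ {n} → Graph n → Set
  Labeling {n} G = Σ (Fin n → Fin n → C) λ f → ∀ u v → f u v ≈ f v u

  weightedDegree : ∀ {n} (G : Graph n) → (Fin n → Fin n → C) → Fin n → C
  weightedDegree {n} G f v =
    foldr (λ u acc → if adj G v u then f u v ∙ acc else acc) ε (allFin n)

  Irregular : ∀ {n} (G : Graph n) → Labeling G → Set
  Irregular G (f , _) =
    ∀ u v → weightedDegree G f u ≈ weightedDegree G f v → u ≡ v

GoodOrder : ∀ {n} → Graph n → ℕ → Set₁
GoodOrder G s = (A : AbelianGroup 0ℓ 0ℓ) → HasOrder A s →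
  Σ (Labeling A G) (Irregular A G)

GroupIrregularityStrength : ∀ {n} → Graph n → ℕ → Set₁
GroupIrregularityStrength G s =
  1 ≤ s × GoodOrder G s × (∀ t → 1 ≤ t → GoodOrder G t → s ≤ t)

module Submission where

-- A labeling into a group of order t has n distinct weighted degrees, so t ≥ n. Conversely, move a
-- group of order n onto Fin n, cut every component into blocks of four vertices, and cut the group
-- into quads ((x , y) , (s , t)) with x ∙ y ≡ s ∙ t, all but one of which also have (x ∙ y) ∙ (x ∙ y) ≡ ε.
-- Matching blocks with quads prescribes distinct target weights. Labelling a walk from a root r
-- alternately with g and g ⁻¹ puts g at its end and ± g at r, the sign given by its parity. In a
-- bipartite component every block consists of two monochromatic pairs, of different colours in
-- the first block, so the contributions at r cancel block by block; in a component with an odd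
-- cycle they are doubles h ∙ h, which an odd closed walk through r removes.

open import Level using (Level; 0ℓ)
open import Algebra.Bundles using (AbelianGroup; RawGroup)
open import Algebra.Structures using (IsAbelianGroup)
open import Algebra.Morphism.Structures using (IsGroupMonomorphism)
import Algebra.Morphism.GroupMonomorphism as GroupMonomorphism
open import Data.Bool using (Bool; true; false; not; if_then_else_; T)
open import Data.Bool.Properties using (T?; not-injective) renaming (_≟_ to _≟ᵇ_)
open import Data.Fin using (Fin; toℕ; fromℕ<)
open import Data.Fin.Properties using (_≟_; any?; toℕ-injective; toℕ<n; toℕ-fromℕ<; injective⇒≤)
open import Data.List using (List; []; _∷_; _++_; [_]; length; filter; filterᵇ; allFin; concatMap; foldr; zip)
open import Data.List.Properties using (++-identityʳ; length-++; length-tabulate; length-filter; filter-≐)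
open import Data.List.Membership.Propositional using (_∈_; _∉_; find; lose)
open import Data.List.Membership.Propositional.Properties
  using (∈-∃++; ∈-allFin; ∈-filter⁺; ∈-filter⁻; ∈-concatMap⁺; ∈-concatMap⁻; ∈-++⁺ˡ; ∈-++⁺ʳ)
open import Data.List.Membership.Propositional.Properties.WithK using (unique∧set⇒bag)
open import Data.List.Relation.Binary.BagAndSetEquality using (∼bag⇒↭)
open import Data.List.Relation.Binary.Permutation.Propositional
  using (_↭_; ↭-refl; ↭-reflexive; ↭-sym; ↭-trans; ↭-prep; ↭-swap; ↭⇒↭ₛ)
open import Data.List.Relation.Binary.Permutation.Propositional.Properties
  using (∈-resp-↭; ↭-length; shift; shifts; ++⁺)
import Data.List.Relation.Binary.Permutation.Setoid.Properties as Permutationₛ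
open import Data.List.Relation.Unary.All using (All; []; _∷_)
import Data.List.Relation.Unary.All as All using (map; zipWith; tabulate; tail)
open import Data.List.Relation.Unary.All.Properties using (All¬⇒¬Any; ¬Any⇒All¬)
import Data.List.Relation.Unary.All.Properties as All using (++⁺)
open import Data.List.Relation.Unary.Any using (here; there)
open import Data.List.Relation.Unary.Unique.Propositional using (Unique; []; _∷_)
import Data.List.Relation.Unary.Unique.Propositional.Properties as Unique
open import Data.Nat using (ℕ; zero; suc; _+_; _*_; _≤_; s≤s; z≤n)
open import Data.Nat.Properties
  using (module ≤-Reasoning; *-suc; *-assoc; *-comm; *-distribˡ-+; +-comm; +-assoc; +-suc; +-identityʳ;
         ≤-refl; ≤-trans; n≤1+n; 1+n≰n; suc-injective)
open import Data.Nat.DivMod using (_%_; %-distribˡ-+; %-distribˡ-*; m*n%n≡0; m<n⇒m%n≡m; m%n<n; m%n%n≡m%n)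
open import Data.Nat.Divisibility
  using (_∣_; divides; ∣m+n∣m⇒∣n; ∣m∣n⇒∣m+n; ∣-refl; ∣-trans; ∣1⇒≡1; *-cancelˡ-∣; m∣m*n)
open import Data.Product using (Σ; ∃; ∃₂; _×_; _,_; proj₁; proj₂)
open import Data.Sum using (_⊎_; inj₁; inj₂)
open import Data.Unit using (⊤)
open import Function using (_∘_; case_of_)
open import Function.Bundles using (_⇔_; mk⇔; Equivalence)
open import Relation.Binary.PropositionalEquality hiding ([_])
open import Relation.Nullary using (¬_; Dec; does; yes; no; ¬?; contradiction)
import Relation.Nullary.Decidable as Dec
open import Relation.Nullary.Decidable using (_×-dec_)
open import Relation.Unary using (Decidable)
open import Defs hiding (sym)

2∣⊎2∣suc : ∀ n → 2 ∣ n ⊎ 2 ∣ suc n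
2∣⊎2∣suc zero = inj₁ (divides 0 refl)
2∣⊎2∣suc (suc n) with 2∣⊎2∣suc n
... | inj₁ 2∣n = inj₂ (∣m∣n⇒∣m+n ∣-refl 2∣n)
... | inj₂ 2∣1+n = inj₁ 2∣1+n

2∣suc⇒¬2∣ : ∀ {n} → 2 ∣ suc n → ¬ 2 ∣ n
2∣suc⇒¬2∣ {n} 2∣1+n 2∣n with ∣1⇒≡1 (∣m+n∣m⇒∣n (subst (2 ∣_) (+-comm 1 n) 2∣1+n) 2∣n)
... | ()

¬2∣1+2* : ∀ k → ¬ 2 ∣ suc (2 * k)
¬2∣1+2* k 2∣ = 2∣suc⇒¬2∣ 2∣ (m∣m*n k)

Quad : ∀ {a} → Set a → Set a
Quad A = (A × A) × (A × A)

private
  variable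
    a : Level
    A : Set a

unique⇒∉ : ∀ {x : A} {xs} → Unique (x ∷ xs) → x ∉ xs
unique⇒∉ (x∉ ∷ _) = All¬⇒¬Any x∉

∈∉⇒≢ : ∀ {x y : A} {xs} → x ∈ xs → y ∉ xs → y ≢ x
∈∉⇒≢ x∈ y∉ refl = y∉ x∈

∉⇒unique : ∀ {x : A} {xs} → x ∉ xs → Unique xs → Unique (x ∷ xs)
∉⇒unique x∉ u = ¬Any⇒All¬ _ x∉ ∷ u

unique-resp-↭ : ∀ {xs ys : List A} → xs ↭ ys → Unique xs → Unique ys
unique-resp-↭ {A = A} p = Permutationₛ.Unique-resp-↭ (setoid A) (↭⇒↭ₛ p)

flatten : List (A × A) → List A
flatten [] = []
flatten ((x , y) ∷ ps) = x ∷ y ∷ flatten ps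

flatten-++ : ∀ (ps qs : List (A × A)) → flatten (ps ++ qs) ≡ flatten ps ++ flatten qs
flatten-++ [] qs = refl
flatten-++ ((x , y) ∷ ps) qs = cong (λ zs → x ∷ y ∷ zs) (flatten-++ ps qs)

length-flatten : ∀ (ps : List (A × A)) → length (flatten ps) ≡ 2 * length ps
length-flatten [] = refl
length-flatten ((x , y) ∷ ps) = trans (cong (2 +_) (length-flatten ps)) (sym (*-suc 2 (length ps)))

pairsOf : List A → List (A × A)
pairsOf (x ∷ y ∷ xs) = (x , y) ∷ pairsOf xs
pairsOf _ = []

flatten-pairsOf : ∀ (xs : List A) → 2 ∣ length xs → flatten (pairsOf xs) ≡ xs
flatten-pairsOf [] _ = refl
flatten-pairsOf (x ∷ []) 2∣1 = contradiction (divides 0 refl) (2∣suc⇒¬2∣ 2∣1)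
flatten-pairsOf (x ∷ y ∷ xs) 2∣ = cong (λ zs → x ∷ y ∷ zs) (flatten-pairsOf xs (∣m+n∣m⇒∣n 2∣ ∣-refl))

pairsOf⁺ : ∀ {p} {P : A → Set p} {xs : List A} → All P xs → All (λ (x , y) → P x × P y) (pairsOf xs)
pairsOf⁺ [] = []
pairsOf⁺ (_ ∷ []) = []
pairsOf⁺ (px ∷ py ∷ pxs) = (px , py) ∷ pairsOf⁺ pxs

flattenQuads : List (Quad A) → List A
flattenQuads qs = flatten (flatten qs)

length-flattenQuads : ∀ (qs : List (Quad A)) → length (flattenQuads qs) ≡ 4 * length qs
length-flattenQuads qs = begin
  length (flatten (flatten qs)) ≡⟨ length-flatten (flatten qs) ⟩
  2 * length (flatten qs)       ≡⟨ cong (2 *_) (length-flatten qs) ⟩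
  2 * (2 * length qs)           ≡⟨ *-assoc 2 2 (length qs) ⟨
  4 * length qs                 ∎
  where open ≡-Reasoning

flattenQuads-pairsOf-++ : ∀ (ps qs : List (A × A)) → 2 ∣ length ps → 2 ∣ length qs →
                          flattenQuads (pairsOf ps ++ pairsOf qs) ≡ flatten ps ++ flatten qs
flattenQuads-pairsOf-++ ps qs 2∣ps 2∣qs = begin
  flatten (flatten (pairsOf ps ++ pairsOf qs))
    ≡⟨ cong flatten (flatten-++ (pairsOf ps) (pairsOf qs)) ⟩
  flatten (flatten (pairsOf ps) ++ flatten (pairsOf qs))
    ≡⟨ cong₂ (λ xs ys → flatten (xs ++ ys)) (flatten-pairsOf ps 2∣ps) (flatten-pairsOf qs 2∣qs) ⟩
  flatten (ps ++ qs)
    ≡⟨ flatten-++ ps qs ⟩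
  flatten ps ++ flatten qs ∎
  where open ≡-Reasoning

flattenQuads-++ : ∀ (qs qs′ : List (Quad A)) → flattenQuads (qs ++ qs′) ≡ flattenQuads qs ++ flattenQuads qs′
flattenQuads-++ qs qs′ = trans (cong flatten (flatten-++ qs qs′)) (flatten-++ (flatten qs) (flatten qs′))

quadsOf : List A → List (Quad A)
quadsOf xs = pairsOf (pairsOf xs)

flattenQuads-quadsOf : ∀ (xs : List A) → 4 ∣ length xs → flattenQuads (quadsOf xs) ≡ xs
flattenQuads-quadsOf xs 4∣ = trans (cong flatten (flatten-pairsOf (pairsOf xs) 2∣pairs)) (flatten-pairsOf xs 2∣xs)
  where
  2∣xs : 2 ∣ length xs
  2∣xs = ∣-trans (divides 2 refl) 4∣
  2∣pairs : 2 ∣ length (pairsOf xs)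
  2∣pairs = *-cancelˡ-∣ 2 (subst (4 ∣_) (trans (cong length (sym (flatten-pairsOf xs 2∣xs))) (length-flatten (pairsOf xs))) 4∣)

HeadAll : {A : Set} → (A → Set) → (A → Set) → List A → Set
HeadAll P Q [] = ⊤
HeadAll P Q (x ∷ xs) = P x × All Q xs

All⇒HeadAll : ∀ {A : Set} {R P Q : A → Set} → (∀ {x} → R x → P x) → (∀ {x} → R x → Q x) →
              ∀ {xs} → All R xs → HeadAll P Q xs
All⇒HeadAll R⇒P R⇒Q [] = _
All⇒HeadAll R⇒P R⇒Q (rx ∷ rxs) = R⇒P rx , All.map R⇒Q rxs

HeadAll-map : ∀ {A : Set} {R P Q P′ Q′ : A → Set} → (∀ {x} → R x → P x → P′ x) → (∀ {x} → R x → Q x → Q′ x) →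
              ∀ {xs} → All R xs → HeadAll P Q xs → HeadAll P′ Q′ xs
HeadAll-map f g [] _ = _
HeadAll-map f g (rx ∷ rxs) (px , qxs) = f rx px , All.zipWith (λ (r , q) → g r q) (rxs , qxs)

All-flattenQuads : ∀ {p} {P : A → Set p} (qs : List (Quad A)) → All P (flattenQuads qs) →
                   All (λ q → All P (flattenQuads (q ∷ []))) qs
All-flattenQuads [] [] = []
All-flattenQuads (((a , b) , (c , d)) ∷ qs) (pa ∷ pb ∷ pc ∷ pd ∷ ps) = (pa ∷ pb ∷ pc ∷ pd ∷ []) ∷ All-flattenQuads qs ps

HeadAll-++ : ∀ {A : Set} {P Q : A → Set} → (∀ {x} → P x → Q x) → ∀ xs ys →
             HeadAll P Q xs → HeadAll P Q ys → HeadAll P Q (xs ++ ys)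
HeadAll-++ P⇒Q [] ys _ hy = hy
HeadAll-++ {P = P} {Q} P⇒Q (x ∷ xs) [] hx _ = subst (HeadAll P Q) (sym (++-identityʳ (x ∷ xs))) hx
HeadAll-++ P⇒Q (x ∷ xs) (y ∷ ys) (px , qxs) (py , qys) = px , All.++⁺ qxs (P⇒Q py ∷ qys)

unique-↭ : ∀ {xs ys : List A} → Unique xs → Unique ys → (∀ x → x ∈ xs ⇔ x ∈ ys) → xs ↭ ys
unique-↭ uxs uys same = ∼bag⇒↭ (unique∧set⇒bag uxs uys (λ {x} → same x))

filterᵇ-partition : ∀ (p : A → Bool) xs → filterᵇ p xs ++ filterᵇ (not ∘ p) xs ↭ xs
filterᵇ-partition p [] = ↭-refl
filterᵇ-partition p (x ∷ xs) with p x
... | true = ↭-prep x (filterᵇ-partition p xs)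
... | false = ↭-trans (shift x (filterᵇ p xs) (filterᵇ (not ∘ p) xs)) (↭-prep x (filterᵇ-partition p xs))

unique-concatMap : ∀ {b} {B : Set b} {f : A → List B} {xs} → Unique xs → (∀ x → Unique (f x)) →
                   (∀ {x y z} → x ∈ xs → y ∈ xs → z ∈ f x → z ∈ f y → x ≡ y) → Unique (concatMap f xs)
unique-concatMap {xs = []} _ _ _ = []
unique-concatMap {f = f} {xs = x ∷ xs} u@(_ ∷ u′) uf same =
  Unique.++⁺ (uf x) (unique-concatMap u′ uf (λ x∈ y∈ → same (there x∈) (there y∈))) disjoint
  where
  disjoint : ∀ {z} → ¬ (z ∈ f x × z ∈ concatMap f xs)
  disjoint (z∈fx , z∈rest) with find (∈-concatMap⁻ f z∈rest)
  ... | y , y∈ , z∈fy = unique⇒∉ u (subst (_∈ xs) (sym (same (here refl) (there y∈) z∈fx z∈fy)) y∈)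

filterᵇ-true : ∀ (p : A → Bool) xs → All (λ x → p x ≡ true) (filterᵇ p xs)
filterᵇ-true p [] = []
filterᵇ-true p (x ∷ xs) with p x in eq
... | true = eq ∷ filterᵇ-true p xs
... | false = filterᵇ-true p xs

∈-filterᵇ⁺ : ∀ (p : A → Bool) {x xs} → x ∈ xs → p x ≡ true → x ∈ filterᵇ p xs
∈-filterᵇ⁺ p {x} x∈ px = ∈-filter⁺ (T? ∘ p) x∈ (subst T (sym px) _)

module _ {X : Set} (c : X → Bool) where

  Monochromatic : Quad X → Set
  Monochromatic ((a , b) , (a′ , b′)) = c a ≡ c b × c a′ ≡ c b′

  Split : Quad X → Set
  Split q@((a , _) , (a′ , _)) = Monochromatic q × c a ≢ c a′

  private
    monochromaticPairs : ∀ {k xs} → All (λ x → c x ≡ k) xs → All (λ (x , y) → c x ≡ c y) (pairsOf xs)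
    monochromaticPairs cxs = All.map (λ (cx , cy) → trans cx (sym cy)) (pairsOf⁺ cxs)

    arrange : ∀ xs ys → All (λ x → c x ≡ true) xs → All (λ y → c y ≡ false) ys →
              2 ∣ length xs → 2 ∣ length ys → 4 ∣ length (xs ++ ys) → ∀ {t f} → t ∈ xs → f ∈ ys →
              ∃ λ qs → HeadAll Split Monochromatic qs × flattenQuads qs ↭ xs ++ ys
    arrange (_ ∷ []) _ _ _ 2∣1 _ _ _ _ = contradiction (divides 0 refl) (2∣suc⇒¬2∣ 2∣1)
    arrange (_ ∷ _ ∷ _) (_ ∷ []) _ _ _ 2∣1 _ _ _ = contradiction (divides 0 refl) (2∣suc⇒¬2∣ 2∣1)
    arrange (a₁ ∷ a₂ ∷ as) (b₁ ∷ b₂ ∷ bs) (ca₁ ∷ ca₂ ∷ cas) (cb₁ ∷ cb₂ ∷ cbs) 2∣as 2∣bs 4∣ _ _ =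
      ((a₁ , a₂) , (b₁ , b₂)) ∷ pairsOf pairs ,
      (((trans ca₁ (sym ca₂) , trans cb₁ (sym cb₂)) , λ eq → true≢false (trans (sym ca₁) (trans eq cb₁))) ,
       pairsOf⁺ (All.++⁺ (monochromaticPairs cas) (monochromaticPairs cbs))) ,
      subst (λ zs → a₁ ∷ a₂ ∷ b₁ ∷ b₂ ∷ zs ↭ (a₁ ∷ a₂ ∷ as) ++ (b₁ ∷ b₂ ∷ bs))
            (sym (trans (cong flatten (flatten-pairsOf pairs 2∣pairs)) flatten-pairs)) regroup
      where
      true≢false : true ≢ false
      true≢false ()
      pairs = pairsOf as ++ pairsOf bs
      flatten-pairs : flatten pairs ≡ as ++ bs
      flatten-pairs = trans (flatten-++ (pairsOf as) (pairsOf bs))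
                            (cong₂ _++_ (flatten-pairsOf as (∣m+n∣m⇒∣n 2∣as ∣-refl))
                                        (flatten-pairsOf bs (∣m+n∣m⇒∣n 2∣bs ∣-refl)))
      regroup : a₁ ∷ a₂ ∷ b₁ ∷ b₂ ∷ as ++ bs ↭ (a₁ ∷ a₂ ∷ as) ++ (b₁ ∷ b₂ ∷ bs)
      regroup = ↭-prep a₁ (↭-prep a₂ (shifts (b₁ ∷ b₂ ∷ []) as))
      2∣pairs : 2 ∣ length pairs
      2∣pairs = *-cancelˡ-∣ 2 (subst (4 ∣_) (trans (cong length (sym flatten-pairs)) (length-flatten pairs))
                  (∣m+n∣m⇒∣n (subst (4 ∣_) (↭-length (↭-sym regroup)) 4∣) ∣-refl))

  bipartiteQuads : ∀ L → 4 ∣ length L → 2 ∣ length (filterᵇ c L) → 2 ∣ length (filterᵇ (not ∘ c) L) →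
                   ∀ {t f} → t ∈ L → c t ≡ true → f ∈ L → c f ≡ false →
                   ∃ λ qs → HeadAll Split Monochromatic qs × flattenQuads qs ↭ L
  bipartiteQuads L 4∣L 2∣A 2∣B t∈ ct f∈ cf with arrange (filterᵇ c L) (filterᵇ (not ∘ c) L)
    (filterᵇ-true c L) (All.map not-injective (filterᵇ-true (not ∘ c) L)) 2∣A 2∣B
    (subst (4 ∣_) (↭-length (↭-sym (filterᵇ-partition c L))) 4∣L)
    (∈-filterᵇ⁺ c t∈ ct) (∈-filterᵇ⁺ (not ∘ c) f∈ (cong not cf))
  ... | qs , heads , flat↭ = qs , heads , ↭-trans flat↭ (filterᵇ-partition c L)

module _ {n : ℕ} where

  ↭-allFin : ∀ {xs : List (Fin n)} → Unique xs → (∀ x → x ∈ xs) → xs ↭ allFin n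
  ↭-allFin u all = unique-↭ u (Unique.allFin⁺ n) (λ x → mk⇔ (λ _ → ∈-allFin x) (λ _ → all x))

  length-allFin : length (allFin n) ≡ n
  length-allFin = length-tabulate (λ i → i)

  module _ {p} {P : Fin n → Set p} (P? : Decidable P) where

    ∈-filter-allFin⁺ : ∀ {x} → P x → x ∈ filter P? (allFin n)
    ∈-filter-allFin⁺ {x} px = ∈-filter⁺ P? (∈-allFin x) px

    ∈-filter-allFin⁻ : ∀ {x} → x ∈ filter P? (allFin n) → P x
    ∈-filter-allFin⁻ x∈ = proj₂ (∈-filter⁻ P? {xs = allFin n} x∈)

    unique-filter-allFin : Unique (filter P? (allFin n))
    unique-filter-allFin = Unique.filter⁺ P? (Unique.allFin⁺ n)

  length-unique≤ : ∀ {xs : List (Fin n)} → Unique xs → length xs ≤ n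
  length-unique≤ {xs} u = begin
    length xs                          ≡⟨ ↭-length (unique-↭ u (unique-filter-allFin (_∈? xs)) same) ⟩
    length (filter (_∈? xs) (allFin n)) ≤⟨ length-filter (_∈? xs) (allFin n) ⟩
    length (allFin n)                  ≡⟨ length-allFin ⟩
    n                                  ∎
    where
    open ≤-Reasoning
    open import Data.List.Membership.DecPropositional (_≟_ {n}) using (_∈?_)
    same : ∀ x → x ∈ xs ⇔ x ∈ filter (_∈? xs) (allFin n)
    same x = mk⇔ (∈-filter-allFin⁺ (_∈? xs)) (∈-filter-allFin⁻ (_∈? xs))

module PairUp {a} {A : Set a} (π : A → A) (π-involutive : ∀ x → π (π x) ≡ x) where

  Paired : A × A → Set a
  Paired (x , y) = y ≡ π x

  record FixpointFreeOn (L : List A) : Set a where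
    field
      unique : Unique L
      closed : ∀ {x} → x ∈ L → π x ∈ L
      fixpointFree : ∀ {x} → x ∈ L → π x ≢ x

  π-injective : ∀ {x y} → π x ≡ π y → x ≡ y
  π-injective {x} {y} eq = trans (sym (π-involutive x)) (trans (cong π eq) (π-involutive y))

  open FixpointFreeOn

  pairUp : ∀ k L → length L ≤ k → FixpointFreeOn L → ∃ λ ps → All Paired ps × flatten ps ↭ L
  pairUp-∷ : ∀ k x L → length L ≤ k → FixpointFreeOn (x ∷ L) →
             ∃ λ ps → All Paired ps × flatten ((x , π x) ∷ ps) ↭ x ∷ L

  pairUp k [] _ _ = [] , [] , ↭-refl
  pairUp k (x ∷ L) |xL|≤k free with pairUp-∷ k x L (≤-trans (n≤1+n _) |xL|≤k) free
  ... | ps , paired , flat↭ = (x , π x) ∷ ps , refl ∷ paired , flat↭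

  pairUp-∷ k x L |L|≤k free with closed free (here refl)
  ... | here πx≡x = contradiction πx≡x (fixpointFree free (here refl))
  ... | there πx∈L with ∈-∃++ πx∈L
  ... | ys , zs , refl with subst (_≤ k) (↭-length L↭) |L|≤k
    where L↭ = shift (π x) ys zs
  ... | s≤s |rest|≤k′ with pairUp _ (ys ++ zs) |rest|≤k′ free′
    where
    L↭ = shift (π x) ys zs
    rest = ys ++ zs
    split : Unique (x ∷ π x ∷ rest) → x ∉ π x ∷ rest × π x ∉ rest × Unique rest
    split u@(_ ∷ u′@(_ ∷ u″)) = unique⇒∉ u , unique⇒∉ u′ , u″
    parts = split (unique-resp-↭ (↭-prep x L↭) (unique free))
    x∉ = proj₁ parts
    πx∉ = proj₁ (proj₂ parts)
    ⊆L : ∀ {y} → y ∈ rest → y ∈ x ∷ ys ++ [ π x ] ++ zs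
    ⊆L y∈ = there (∈-resp-↭ (↭-sym L↭) (there y∈))
    closed′ : ∀ {y} → y ∈ rest → π y ∈ rest
    closed′ {y} y∈ with ∈-resp-↭ (↭-prep x L↭) (closed free (⊆L y∈))
    ... | here πy≡x = contradiction (subst (_∈ rest) (trans (sym (π-involutive y)) (cong π πy≡x)) y∈) πx∉
    ... | there (here πy≡πx) = contradiction (subst (_∈ rest) (π-injective πy≡πx) y∈) (x∉ ∘ there)
    ... | there (there πy∈) = πy∈
    free′ : FixpointFreeOn rest
    free′ = record
      { unique = proj₂ (proj₂ parts)
      ; closed = closed′
      ; fixpointFree = fixpointFree free ∘ ⊆L }
  ... | ps , paired , flat↭ =
    ps , paired , ↭-prep x (↭-trans (↭-prep (π x) flat↭) (↭-sym (shift (π x) ys zs)))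


module GroupSums {C : Set} {op : C → C → C} {e : C} {inv : C → C}
            (isAbelianGroup : IsAbelianGroup _≡_ op e inv) where

  Γ : AbelianGroup 0ℓ 0ℓ
  Γ = record { isAbelianGroup = isAbelianGroup }

  open AbelianGroup Γ public
    using (_∙_; ε; _⁻¹; assoc; comm; identityˡ; identityʳ; inverseˡ; inverseʳ; commutativeMonoid)
  open import Algebra.Properties.AbelianGroup Γ public
    using (⁻¹-∙-comm; ⁻¹-involutive; ⁻¹-injective; ε⁻¹≈ε; inverseʳ-unique)
  open import Algebra.Solver.CommutativeMonoid commutativeMonoid using (solve; _⊜_; _⊕_) renaming (id to ∅)
  open import Algebra.Properties.CommutativeSemigroup (AbelianGroup.commutativeSemigroup Γ) public
    using (interchange)
  open ≡-Reasoning

  ∑ : ∀ {a} {X : Set a} → List X → (X → C) → C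
  ∑ [] f = ε
  ∑ (x ∷ xs) f = f x ∙ ∑ xs f

  module _ {a} {X : Set a} where

    ∑-++ : ∀ (xs ys : List X) f → ∑ (xs ++ ys) f ≡ ∑ xs f ∙ ∑ ys f
    ∑-++ [] ys f = sym (identityˡ _)
    ∑-++ (x ∷ xs) ys f = trans (cong (f x ∙_) (∑-++ xs ys f)) (sym (assoc _ _ _))

    ∑-∙ : ∀ (xs : List X) f g → ∑ xs (λ x → f x ∙ g x) ≡ ∑ xs f ∙ ∑ xs g
    ∑-∙ [] f g = sym (identityˡ ε)
    ∑-∙ (x ∷ xs) f g = trans (cong (f x ∙ g x ∙_) (∑-∙ xs f g)) (interchange _ _ _ _)

    ∑-cong : ∀ (xs : List X) {f g} → (∀ x → f x ≡ g x) → ∑ xs f ≡ ∑ xs g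
    ∑-cong [] f≗g = refl
    ∑-cong (x ∷ xs) f≗g = cong₂ _∙_ (f≗g x) (∑-cong xs f≗g)

    ∑-ε : ∀ (xs : List X) {f} → (∀ x → f x ≡ ε) → ∑ xs f ≡ ε
    ∑-ε [] _ = refl
    ∑-ε (x ∷ xs) f≗ε = trans (cong₂ _∙_ (f≗ε x) (∑-ε xs f≗ε)) (identityˡ ε)

  module _ {n : ℕ} where

    infix 5 _↦_

    _↦_ : Fin n → C → Fin n → C
    (a ↦ g) x = if does (a ≟ x) then g else ε

    ↦-≡ : ∀ a g → (a ↦ g) a ≡ g
    ↦-≡ a g with a ≟ a
    ... | yes _ = refl
    ... | no a≢a = contradiction refl a≢a

    ↦-≢ : ∀ {a x} g → a ≢ x → (a ↦ g) x ≡ ε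
    ↦-≢ {a} {x} g a≢x with a ≟ x
    ... | yes a≡x = contradiction a≡x a≢x
    ... | no _ = refl

    ↦-∙ : ∀ a g h x → (a ↦ g) x ∙ (a ↦ h) x ≡ (a ↦ g ∙ h) x
    ↦-∙ a g h x with a ≟ x
    ... | yes _ = refl
    ... | no _ = identityˡ ε

    ↦-swap : ∀ a b g u v → (a ↦ (b ↦ g) v) u ≡ (b ↦ (a ↦ g) u) v
    ↦-swap a b g u v with a ≟ u | b ≟ v
    ... | yes _ | yes _ = refl
    ... | yes _ | no _ = refl
    ... | no _ | yes _ = refl
    ... | no _ | no _ = refl

    ↦-ε : ∀ a x → (a ↦ ε) x ≡ ε
    ↦-ε a x with a ≟ x
    ... | yes _ = refl
    ... | no _ = refl

    ↦-inverseʳ : ∀ a g x → (a ↦ g) x ∙ (a ↦ g ⁻¹) x ≡ ε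
    ↦-inverseʳ a g x = trans (↦-∙ a g (g ⁻¹) x) (trans (cong (λ h → (a ↦ h) x) (inverseʳ g)) (↦-ε a x))

    ↦-inverseˡ : ∀ a g x → (a ↦ g ⁻¹) x ∙ (a ↦ g) x ≡ ε
    ↦-inverseˡ a g x = trans (comm _ _) (↦-inverseʳ a g x)

    ∑-point-∉ : ∀ {a} g xs → a ∉ xs → ∑ xs (a ↦ g) ≡ ε
    ∑-point-∉ g [] _ = refl
    ∑-point-∉ g (x ∷ xs) a∉ =
      trans (cong₂ _∙_ (↦-≢ g (a∉ ∘ here)) (∑-point-∉ g xs (a∉ ∘ there))) (identityˡ ε)

    ∑-point : ∀ {a} g xs → Unique xs → a ∈ xs → ∑ xs (a ↦ g) ≡ g
    ∑-point {a} g (x ∷ xs) u (here refl) =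
      trans (cong₂ _∙_ (↦-≡ a g) (∑-point-∉ g xs (unique⇒∉ u))) (identityʳ g)
    ∑-point {a} g (x ∷ xs) (x∉ ∷ u) (there a∈) with a ≟ x
    ... | yes refl = contradiction a∈ (unique⇒∉ (x∉ ∷ u))
    ... | no _ = trans (identityˡ _) (∑-point g xs u a∈)

    target : List (Fin n × C) → Fin n → C
    target E x = ∑ E (λ (u , g) → (u ↦ g) x)

    target-zip-there : ∀ {a x} g xs gs → a ≢ x → target (zip (a ∷ xs) (g ∷ gs)) x ≡ target (zip xs gs) x
    target-zip-there g xs gs a≢x = trans (cong (_∙ _) (↦-≢ g a≢x)) (identityˡ _)

    target-zip-∉ : ∀ {x} xs gs → x ∉ xs → target (zip xs gs) x ≡ ε
    target-zip-∉ [] gs _ = refl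
    target-zip-∉ (a ∷ xs) [] _ = refl
    target-zip-∉ (a ∷ xs) (g ∷ gs) x∉ =
      trans (target-zip-there g xs gs (≢-sym (∈∉⇒≢ (here refl) x∉))) (target-zip-∉ xs gs (x∉ ∘ there))

    target-zip-here : ∀ {a} g xs gs → a ∉ xs → target (zip (a ∷ xs) (g ∷ gs)) a ≡ g
    target-zip-here {a} g xs gs a∉ = trans (cong₂ _∙_ (↦-≡ a g) (target-zip-∉ xs gs a∉)) (identityʳ g)

    target-zip-∈ : ∀ {x} xs gs → Unique xs → length xs ≡ length gs → x ∈ xs → target (zip xs gs) x ∈ gs
    target-zip-∈ (a ∷ xs) (g ∷ gs) u _ (here refl) = here (target-zip-here g xs gs (unique⇒∉ u))
    target-zip-∈ (a ∷ xs) (g ∷ gs) u@(_ ∷ u′) len (there x∈) =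
      there (subst (_∈ gs) (sym (target-zip-there g xs gs (∈∉⇒≢ x∈ (unique⇒∉ u))))
                   (target-zip-∈ xs gs u′ (suc-injective len) x∈))

    target-zip-head≢ : ∀ {a y} g xs gs → Unique (a ∷ xs) → Unique (g ∷ gs) → length xs ≡ length gs → y ∈ xs →
                       target (zip (a ∷ xs) (g ∷ gs)) a ≢ target (zip (a ∷ xs) (g ∷ gs)) y
    target-zip-head≢ g xs gs ux@(_ ∷ ux′) ug len y∈ eq =
      unique⇒∉ ug (subst (_∈ gs) (sym g≡) (target-zip-∈ xs gs ux′ len y∈))
      where
      g≡ : g ≡ target (zip xs gs) _
      g≡ = trans (sym (target-zip-here g xs gs (unique⇒∉ ux)))
                 (trans eq (target-zip-there g xs gs (∈∉⇒≢ y∈ (unique⇒∉ ux))))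

    target-zip-injective : ∀ xs gs → Unique xs → Unique gs → length xs ≡ length gs →
                           ∀ {x y} → x ∈ xs → y ∈ xs → target (zip xs gs) x ≡ target (zip xs gs) y → x ≡ y
    target-zip-injective (a ∷ xs) (g ∷ gs) ux ug len (here refl) (here refl) _ = refl
    target-zip-injective (a ∷ xs) (g ∷ gs) ux ug len (here refl) (there y∈) eq =
      contradiction eq (target-zip-head≢ g xs gs ux ug (suc-injective len) y∈)
    target-zip-injective (a ∷ xs) (g ∷ gs) ux ug len (there x∈) (here refl) eq =
      contradiction (sym eq) (target-zip-head≢ g xs gs ux ug (suc-injective len) x∈)
    target-zip-injective (a ∷ xs) (g ∷ gs) ux@(_ ∷ ux′) (_ ∷ ug′) len (there x∈) (there y∈) eq =
      target-zip-injective xs gs ux′ ug′ (suc-injective len) x∈ y∈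
        (trans (sym (target-zip-there g xs gs (∈∉⇒≢ x∈ (unique⇒∉ ux))))
          (trans eq (target-zip-there g xs gs (∈∉⇒≢ y∈ (unique⇒∉ ux)))))

  signed : Bool → C → C
  signed true g = g
  signed false g = g ⁻¹

  signed-not : ∀ c g → signed (not c) g ≡ signed c (g ⁻¹)
  signed-not true g = refl
  signed-not false g = sym (⁻¹-involutive g)

  signed-involutive : ∀ c g → signed c (signed c g) ≡ g
  signed-involutive true g = refl
  signed-involutive false g = ⁻¹-involutive g

  signed-∙ : ∀ c g h → signed c g ∙ signed c h ≡ signed c (g ∙ h)
  signed-∙ true g h = refl
  signed-∙ false g h = ⁻¹-∙-comm g h

  signed-cancel : ∀ c c′ g → c ≢ c′ ⊎ g ∙ g ≡ ε → signed c g ∙ signed c′ g ≡ ε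
  signed-cancel true true g (inj₁ c≢c′) = contradiction refl c≢c′
  signed-cancel false false g (inj₁ c≢c′) = contradiction refl c≢c′
  signed-cancel true true g (inj₂ g²≡ε) = g²≡ε
  signed-cancel false false g (inj₂ g²≡ε) = trans (⁻¹-∙-comm g g) (trans (cong _⁻¹ g²≡ε) ε⁻¹≈ε)
  signed-cancel true false g _ = inverseʳ g
  signed-cancel false true g _ = inverseˡ g

  IsDouble : C → Set
  IsDouble h = ∃ λ k → h ≡ k ∙ k

  signed≡∙double : ∀ c g → ∃ λ k → signed c g ≡ g ∙ (k ∙ k)
  signed≡∙double true g = ε , sym (trans (cong (g ∙_) (identityˡ ε)) (identityʳ g))
  signed≡∙double false g = g ⁻¹ , (begin
    g ⁻¹               ≡⟨ identityˡ (g ⁻¹) ⟨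
    ε ∙ g ⁻¹           ≡⟨ cong (_∙ g ⁻¹) (inverseʳ g) ⟨
    (g ∙ g ⁻¹) ∙ g ⁻¹  ≡⟨ assoc g (g ⁻¹) (g ⁻¹) ⟩
    g ∙ (g ⁻¹ ∙ g ⁻¹)  ∎)

  Balanced : Quad C → Set
  Balanced ((x , y) , (s , t)) = x ∙ y ≡ s ∙ t

  StronglyBalanced : Quad C → Set
  StronglyBalanced q@((x , y) , _) = Balanced q × (x ∙ y) ∙ (x ∙ y) ≡ ε

  module _ {c₁ c₂ c₃ c₄ : Bool} {x y s t : C} where

    private
      quadSum : C
      quadSum = signed c₁ x ∙ (signed c₂ y ∙ (signed c₃ s ∙ (signed c₄ t ∙ ε)))

    signed-quad-cancel : c₁ ≡ c₂ → c₃ ≡ c₄ → x ∙ y ≡ s ∙ t → c₁ ≢ c₃ ⊎ (x ∙ y) ∙ (x ∙ y) ≡ ε → quadSum ≡ ε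
    signed-quad-cancel refl refl balanced cancels = begin
      signed c₁ x ∙ (signed c₁ y ∙ (signed c₃ s ∙ (signed c₃ t ∙ ε)))
        ≡⟨ solve 4 (λ a b c d → a ⊕ (b ⊕ (c ⊕ (d ⊕ ∅))) ⊜ (a ⊕ b) ⊕ (c ⊕ d)) refl _ _ _ _ ⟩
      (signed c₁ x ∙ signed c₁ y) ∙ (signed c₃ s ∙ signed c₃ t)
        ≡⟨ cong₂ _∙_ (signed-∙ c₁ x y) (trans (signed-∙ c₃ s t) (cong (signed c₃) (sym balanced))) ⟩
      signed c₁ (x ∙ y) ∙ signed c₃ (x ∙ y)
        ≡⟨ signed-cancel c₁ c₃ (x ∙ y) cancels ⟩
      ε ∎

    signed-quad-double : x ∙ y ≡ s ∙ t → IsDouble quadSum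
    signed-quad-double balanced with signed≡∙double c₁ x | signed≡∙double c₂ y | signed≡∙double c₃ s | signed≡∙double c₄ t
    ... | k₁ , e₁ | k₂ , e₂ | k₃ , e₃ | k₄ , e₄ = (x ∙ y) ∙ (k₁ ∙ (k₂ ∙ (k₃ ∙ k₄))) , (begin
      signed c₁ x ∙ (signed c₂ y ∙ (signed c₃ s ∙ (signed c₄ t ∙ ε)))
        ≡⟨ cong₂ _∙_ e₁ (cong₂ _∙_ e₂ (cong₂ _∙_ e₃ (cong (_∙ ε) e₄))) ⟩
      (x ∙ (k₁ ∙ k₁)) ∙ ((y ∙ (k₂ ∙ k₂)) ∙ ((s ∙ (k₃ ∙ k₃)) ∙ ((t ∙ (k₄ ∙ k₄)) ∙ ε)))
        ≡⟨ solve 8 (λ x y s t k₁ k₂ k₃ k₄ →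
             (x ⊕ (k₁ ⊕ k₁)) ⊕ ((y ⊕ (k₂ ⊕ k₂)) ⊕ ((s ⊕ (k₃ ⊕ k₃)) ⊕ ((t ⊕ (k₄ ⊕ k₄)) ⊕ ∅)))
             ⊜ ((x ⊕ y) ⊕ (s ⊕ t)) ⊕ (K k₁ k₂ k₃ k₄ ⊕ K k₁ k₂ k₃ k₄)) refl x y s t k₁ k₂ k₃ k₄ ⟩
      ((x ∙ y) ∙ (s ∙ t)) ∙ (k ∙ k)
        ≡⟨ cong (λ p → ((x ∙ y) ∙ p) ∙ (k ∙ k)) (sym balanced) ⟩
      ((x ∙ y) ∙ (x ∙ y)) ∙ (k ∙ k)
        ≡⟨ interchange (x ∙ y) (x ∙ y) k k ⟩
      ((x ∙ y) ∙ k) ∙ ((x ∙ y) ∙ k) ∎)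
      where
      k = k₁ ∙ (k₂ ∙ (k₃ ∙ k₄))
      K = λ a b c d → a ⊕ (b ⊕ (c ⊕ d))


module GroupQuads {m : ℕ} {op : Fin m → Fin m → Fin m} {e : Fin m} {inv : Fin m → Fin m}
                  (isAbelianGroup : IsAbelianGroup _≡_ op e inv) where

  open GroupSums isAbelianGroup
  open ≡-Reasoning

  x∙x≡ε⇒x⁻¹≡x : ∀ {x} → x ∙ x ≡ ε → x ⁻¹ ≡ x
  x∙x≡ε⇒x⁻¹≡x {x} x²≡ε = sym (inverseʳ-unique x x x²≡ε)

  x⁻¹≡x⇒x∙x≡ε : ∀ {x} → x ⁻¹ ≡ x → x ∙ x ≡ ε
  x⁻¹≡x⇒x∙x≡ε {x} eq = trans (cong (x ∙_) (sym eq)) (inverseʳ x)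

  -- Otherwise x ↦ x ⁻¹ pairs off the non-identity elements, and m would be odd.
  involution : 2 ∣ m → ∃ λ ι → ι ≢ ε × ι ∙ ι ≡ ε
  involution 2∣m with any? (λ x → ¬? (x ≟ ε) ×-dec (x ∙ x ≟ ε))
  ... | yes (ι , ι≢ε , ι²≡ε) = ι , ι≢ε , ι²≡ε
  ... | no none = contradiction (subst (2 ∣_) m≡odd 2∣m) (¬2∣1+2* (length ps))
    where
    open PairUp _⁻¹ ⁻¹-involutive
    nonzero? = λ x → ¬? (x ≟ ε)
    L = filter nonzero? (allFin m)
    free : FixpointFreeOn L
    free = record
      { unique = unique-filter-allFin nonzero?
      ; closed = λ {x} x∈ → ∈-filter-allFin⁺ nonzero? (∈-filter-allFin⁻ nonzero? x∈ ∘ λ x⁻¹≡ε →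
                   ⁻¹-injective (trans x⁻¹≡ε (sym ε⁻¹≈ε)))
      ; fixpointFree = λ {x} x∈ x⁻¹≡x → none (x , ∈-filter-allFin⁻ nonzero? x∈ , x⁻¹≡x⇒x∙x≡ε x⁻¹≡x) }
    paired = pairUp (length L) L ≤-refl free
    ps = proj₁ paired
    ε∷L↭ : ε ∷ L ↭ allFin m
    ε∷L↭ = ↭-allFin (∉⇒unique (λ ε∈ → ∈-filter-allFin⁻ nonzero? ε∈ refl) (unique-filter-allFin nonzero?))
             λ x → case x ≟ ε of λ { (yes refl) → here refl ; (no x≢ε) → there (∈-filter-allFin⁺ nonzero? x≢ε) }
    m≡odd : m ≡ suc (2 * length ps)
    m≡odd = begin
      m                              ≡⟨ length-allFin ⟨
      length (allFin m)              ≡⟨ ↭-length ε∷L↭ ⟨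
      suc (length L)                 ≡⟨ cong suc (↭-length (proj₂ (proj₂ paired))) ⟨
      suc (length (flatten ps))      ≡⟨ cong suc (length-flatten ps) ⟩
      suc (2 * length ps)            ∎

  QuadDecomposition : Set
  QuadDecomposition = ∃ λ qs → HeadAll Balanced StronglyBalanced qs × flattenQuads qs ↭ allFin m

  pairSum : Fin m × Fin m → Fin m
  pairSum (x , y) = x ∙ y

  pairsOf-stronglyBalanced : ∀ {σ} → σ ∙ σ ≡ ε → ∀ {ps} → All (λ p → pairSum p ≡ σ) ps →
                             All StronglyBalanced (pairsOf ps)
  pairsOf-stronglyBalanced σ²≡ε sums =
    All.map (λ (p≡σ , q≡σ) → trans p≡σ (sym q≡σ) , trans (cong (λ z → z ∙ z) p≡σ) σ²≡ε) (pairsOf⁺ sums)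

  -- Pair x with ι ∙ x ⁻¹ (sum ι) when x ∙ x ≢ ι, and with x ⁻¹ (sum ε) when x ∙ x ≡ ι;
  -- two pairs with the same sum form a quad.
  module WithInvolution (ι : Fin m) (ι≢ε : ι ≢ ε) (ι²≡ε : ι ∙ ι ≡ ε) where

    reflect : Fin m → Fin m
    reflect x = ι ∙ x ⁻¹

    reflect-involutive : ∀ x → reflect (reflect x) ≡ x
    reflect-involutive x = begin
      ι ∙ (ι ∙ x ⁻¹) ⁻¹        ≡⟨ cong (ι ∙_) (⁻¹-∙-comm ι (x ⁻¹)) ⟨
      ι ∙ (ι ⁻¹ ∙ x ⁻¹ ⁻¹)     ≡⟨ cong (λ z → ι ∙ (ι ⁻¹ ∙ z)) (⁻¹-involutive x) ⟩
      ι ∙ (ι ⁻¹ ∙ x)           ≡⟨ assoc ι (ι ⁻¹) x ⟨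
      (ι ∙ ι ⁻¹) ∙ x           ≡⟨ cong (_∙ x) (inverseʳ ι) ⟩
      ε ∙ x                    ≡⟨ identityˡ x ⟩
      x                        ∎

    ∙-reflect : ∀ x → x ∙ reflect x ≡ ι
    ∙-reflect x = begin
      x ∙ (ι ∙ x ⁻¹)  ≡⟨ cong (x ∙_) (comm ι (x ⁻¹)) ⟩
      x ∙ (x ⁻¹ ∙ ι)  ≡⟨ assoc x (x ⁻¹) ι ⟨
      (x ∙ x ⁻¹) ∙ ι  ≡⟨ cong (_∙ ι) (inverseʳ x) ⟩
      ε ∙ ι           ≡⟨ identityˡ ι ⟩
      ι               ∎

    square-reflect : ∀ x → reflect x ∙ reflect x ≡ (x ∙ x) ⁻¹
    square-reflect x = begin
      (ι ∙ x ⁻¹) ∙ (ι ∙ x ⁻¹)  ≡⟨ interchange ι (x ⁻¹) ι (x ⁻¹) ⟩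
      (ι ∙ ι) ∙ (x ⁻¹ ∙ x ⁻¹)  ≡⟨ cong₂ _∙_ ι²≡ε (⁻¹-∙-comm x x) ⟩
      ε ∙ (x ∙ x) ⁻¹           ≡⟨ identityˡ _ ⟩
      (x ∙ x) ⁻¹               ∎

    ι⁻¹≡ι : ι ⁻¹ ≡ ι
    ι⁻¹≡ι = x∙x≡ε⇒x⁻¹≡x ι²≡ε

    square≡ι? = λ x → x ∙ x ≟ ι
    nonzero∧square≢ι? = λ x → ¬? (x ≟ ε) ×-dec ¬? (x ∙ x ≟ ι)

    L₁ L₂ : List (Fin m)
    L₁ = ε ∷ filter nonzero∧square≢ι? (allFin m)
    L₂ = filter square≡ι? (allFin m)

    ∈L₁⁻ : ∀ {x} → x ∈ L₁ → x ∙ x ≢ ι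
    ∈L₁⁻ (here refl) ε²≡ι = ι≢ε (trans (sym ε²≡ι) (identityˡ ε))
    ∈L₁⁻ (there x∈) = proj₂ (∈-filter-allFin⁻ nonzero∧square≢ι? x∈)

    ∈L₁⁺ : ∀ {x} → x ∙ x ≢ ι → x ∈ L₁
    ∈L₁⁺ {x} x²≢ι with x ≟ ε
    ... | yes refl = here refl
    ... | no x≢ε = there (∈-filter-allFin⁺ nonzero∧square≢ι? (x≢ε , x²≢ι))

    free₁ : PairUp.FixpointFreeOn reflect reflect-involutive L₁
    free₁ = record
      { unique = ∉⇒unique (λ ε∈ → proj₁ (∈-filter-allFin⁻ nonzero∧square≢ι? ε∈) refl)
                          (unique-filter-allFin nonzero∧square≢ι?)
      ; closed = λ x∈ → ∈L₁⁺ λ sq≡ι → ∈L₁⁻ x∈ (⁻¹-injective (trans (sym (square-reflect _)) (trans sq≡ι (sym ι⁻¹≡ι))))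
      ; fixpointFree = λ {x} x∈ rx≡x → ∈L₁⁻ x∈ (trans (cong (x ∙_) (sym rx≡x)) (∙-reflect x)) }

    free₂ : PairUp.FixpointFreeOn _⁻¹ ⁻¹-involutive L₂
    free₂ = record
      { unique = unique-filter-allFin square≡ι?
      ; closed = λ {x} x∈ → ∈-filter-allFin⁺ square≡ι?
                   (trans (⁻¹-∙-comm x x) (trans (cong _⁻¹ (∈-filter-allFin⁻ square≡ι? x∈)) ι⁻¹≡ι))
      ; fixpointFree = λ {x} x∈ x⁻¹≡x → ι≢ε (trans (sym (∈-filter-allFin⁻ square≡ι? x∈)) (x⁻¹≡x⇒x∙x≡ε x⁻¹≡x)) }

    L₁++L₂↭ : L₁ ++ L₂ ↭ allFin m
    L₁++L₂↭ = ↭-allFin (Unique.++⁺ (PairUp.FixpointFreeOn.unique free₁) (unique-filter-allFin square≡ι?)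
                          (λ (x∈₁ , x∈₂) → ∈L₁⁻ x∈₁ (∈-filter-allFin⁻ square≡ι? x∈₂)))
                        covers
      where
      covers : ∀ x → x ∈ L₁ ++ L₂
      covers x with square≡ι? x
      ... | yes x²≡ι = ∈-++⁺ʳ L₁ (∈-filter-allFin⁺ square≡ι? x²≡ι)
      ... | no x²≢ι = ∈-++⁺ˡ (∈L₁⁺ x²≢ι)

    L₁′ : List (Fin m)
    L₁′ = filter nonzero∧square≢ι? (allFin m)

    paired₁ : ∃ λ ps → All (PairUp.Paired reflect reflect-involutive) ps × flatten ((ε , reflect ε) ∷ ps) ↭ L₁
    paired₁ = PairUp.pairUp-∷ reflect reflect-involutive (length L₁′) ε L₁′ ≤-refl free₁

    paired₂ : ∃ λ ps → All (PairUp.Paired _⁻¹ ⁻¹-involutive) ps × flatten ps ↭ L₂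
    paired₂ = PairUp.pairUp _⁻¹ ⁻¹-involutive (length L₂) L₂ ≤-refl free₂

    ps₁ ps₂ P₁ : List (Fin m × Fin m)
    ps₁ = proj₁ paired₁
    ps₂ = proj₁ paired₂
    P₁ = (ε , reflect ε) ∷ ps₁

    sums₁ : All (λ p → pairSum p ≡ ι) P₁
    sums₁ = All.map (λ {(x , y)} y≡ → trans (cong (x ∙_) y≡) (∙-reflect x)) (refl ∷ proj₁ (proj₂ paired₁))

    sums₂ : All (λ p → pairSum p ≡ ε) ps₂
    sums₂ = All.map (λ {(x , y)} y≡ → trans (cong (x ∙_) y≡) (inverseʳ x)) (proj₁ (proj₂ paired₂))

    pairs↭ : flatten P₁ ++ flatten ps₂ ↭ allFin m
    pairs↭ = ↭-trans (++⁺ (proj₂ (proj₂ paired₁)) (proj₂ (proj₂ paired₂))) L₁++L₂↭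

    2∣pairs : 4 ∣ m → 2 ∣ length P₁ + length ps₂
    2∣pairs 4∣m = *-cancelˡ-∣ 2 (subst (4 ∣_) m≡ 4∣m)
      where
      m≡ : m ≡ 2 * (length P₁ + length ps₂)
      m≡ = begin
        m                                          ≡⟨ length-allFin ⟨
        length (allFin m)                          ≡⟨ ↭-length pairs↭ ⟨
        length (flatten P₁ ++ flatten ps₂)         ≡⟨ length-++ (flatten P₁) ⟩
        length (flatten P₁) + length (flatten ps₂) ≡⟨ cong₂ _+_ (length-flatten P₁) (length-flatten ps₂) ⟩
        2 * length P₁ + 2 * length ps₂             ≡⟨ *-distribˡ-+ 2 (length P₁) (length ps₂) ⟨
        2 * (length P₁ + length ps₂)               ∎

    evenQuads : 2 ∣ length P₁ → 2 ∣ length ps₂ → QuadDecomposition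
    evenQuads 2∣P₁ 2∣ps₂ =
      pairsOf P₁ ++ pairsOf ps₂ ,
      All⇒HeadAll proj₁ (λ sb → sb) (All.++⁺ (pairsOf-stronglyBalanced ι²≡ε sums₁)
                                            (pairsOf-stronglyBalanced (identityˡ ε) sums₂)) ,
      subst (_↭ allFin m) (sym (flattenQuads-pairsOf-++ P₁ ps₂ 2∣P₁ 2∣ps₂)) pairs↭

    -- The leftover pairs (ε , ι) and (b , b ⁻¹) with b ∙ b ≡ ι form the one quad that is only Balanced.
    mixedQuads : 2 ∣ length ps₁ → ∀ qs₂ → All (PairUp.Paired _⁻¹ ⁻¹-involutive) qs₂ → flatten qs₂ ↭ L₂ →
                 All (λ p → pairSum p ≡ ε) qs₂ → 2 ∣ length P₁ + length qs₂ → flatten P₁ ++ flatten qs₂ ↭ allFin m →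
                 QuadDecomposition
    mixedQuads 2∣ps₁ [] _ _ _ 2∣ _ = contradiction 2∣ps₁ (2∣suc⇒¬2∣ (subst (2 ∣_) (+-identityʳ _) 2∣))
    mixedQuads 2∣ps₁ ((b , b′) ∷ qs₂) (b′≡ ∷ _) flat↭ (_ ∷ sums) 2∣ ↭allFin =
      ((ε , b) , (reflect ε , b′)) ∷ pairsOf ps₁ ++ pairsOf qs₂ ,
      (balanced , All.++⁺ (pairsOf-stronglyBalanced ι²≡ε (All.tail sums₁)) (pairsOf-stronglyBalanced (identityˡ ε) sums)) ,
      ↭-trans (subst (_↭ flatten P₁ ++ flatten ((b , b′) ∷ qs₂))
                     (sym (cong (λ zs → ε ∷ b ∷ reflect ε ∷ b′ ∷ zs) (flattenQuads-pairsOf-++ ps₁ qs₂ 2∣ps₁ 2∣qs₂)))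
                     regroup)
              ↭allFin
      where
      b²≡ι : b ∙ b ≡ ι
      b²≡ι = ∈-filter-allFin⁻ square≡ι? (∈-resp-↭ flat↭ (here refl))
      2∣qs₂ : 2 ∣ length qs₂
      2∣qs₂ = ∣m+n∣m⇒∣n (∣m+n∣m⇒∣n (subst (2 ∣_) (cong suc (+-suc (length ps₁) (length qs₂))) 2∣) ∣-refl) 2∣ps₁
      balanced : ε ∙ b ≡ reflect ε ∙ b′
      balanced = begin
        ε ∙ b                ≡⟨ identityˡ b ⟩
        b                    ≡⟨ identityʳ b ⟨
        b ∙ ε                ≡⟨ cong (b ∙_) (inverseʳ b) ⟨
        b ∙ (b ∙ b ⁻¹)       ≡⟨ assoc b b (b ⁻¹) ⟨
        (b ∙ b) ∙ b ⁻¹       ≡⟨ cong₂ _∙_ (trans b²≡ι (sym (identityʳ ι))) (sym b′≡) ⟩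
        (ι ∙ ε) ∙ b′         ≡⟨ cong (λ z → (ι ∙ z) ∙ b′) ε⁻¹≈ε ⟨
        reflect ε ∙ b′       ∎
      regroup : ε ∷ b ∷ reflect ε ∷ b′ ∷ flatten ps₁ ++ flatten qs₂ ↭ flatten P₁ ++ flatten ((b , b′) ∷ qs₂)
      regroup = ↭-prep ε (↭-trans (↭-swap b (reflect ε) ↭-refl) (↭-prep (reflect ε) (shifts (b ∷ b′ ∷ []) (flatten ps₁))))

    quads : 4 ∣ m → QuadDecomposition
    quads 4∣m with 2∣⊎2∣suc (length ps₁)
    ... | inj₂ 2∣P₁ = evenQuads 2∣P₁ (∣m+n∣m⇒∣n (2∣pairs 4∣m) 2∣P₁)
    ... | inj₁ 2∣ps₁ = mixedQuads 2∣ps₁ ps₂ (proj₁ (proj₂ paired₂)) (proj₂ (proj₂ paired₂)) sums₂ (2∣pairs 4∣m) pairs↭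

  groupQuads : 4 ∣ m → QuadDecomposition
  groupQuads 4∣m with involution (∣-trans (divides 2 refl) 4∣m)
  ... | ι , ι≢ε , ι²≡ε = WithInvolution.quads ι ι≢ε ι²≡ε 4∣m


module Walks {n : ℕ} (G : Graph n) where

  adj-sym : ∀ {u v} → Adj G u v → Adj G v u
  adj-sym {u} {v} a = trans (Graph.sym G v u) a

  parity : ∀ {u v} → Reach G u v → Bool
  parity here = false
  parity (step p _) = not (parity p)

  _◅_ : ∀ {u v w} → Adj G u v → Reach G v w → Reach G u w
  a ◅ here = step here a
  a ◅ step p b = step (a ◅ p) b

  _◅◅_ : ∀ {u v w} → Reach G u v → Reach G v w → Reach G u w
  p ◅◅ here = p
  p ◅◅ step q a = step (p ◅◅ q) a

  reverse : ∀ {u v} → Reach G u v → Reach G v u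
  reverse here = here
  reverse (step p a) = adj-sym a ◅ reverse p

  lastEdge : ∀ {r u} → Reach G r u → u ≢ r → ∃ λ v → Reach G r v × Adj G v u
  lastEdge here u≢r = contradiction refl u≢r
  lastEdge (step p a) _ = _ , p , a

module Components {n : ℕ} (G : Graph n) where

  open Walks G
  open import Data.List.Membership.DecPropositional (_≟_ {n}) using (_∈?_)

  record Explored (v : Fin n) (S : List (Fin n)) : Set where
    field
      unique : Unique S
      root∈ : v ∈ S
      reachable : ∀ {u} → u ∈ S → Reach G v u
  open Explored

  LeavingEdge : List (Fin n) → Set
  LeavingEdge S = ∃₂ λ w u → w ∈ S × u ∉ S × Adj G w u

  leavingEdge? : ∀ S → Dec (LeavingEdge S)
  leavingEdge? S = Dec.map′ (λ (w , u , p) → w , u , p) (λ (w , u , p) → w , u , p)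
    (any? λ w → any? λ u → w ∈? S ×-dec ¬? (u ∈? S) ×-dec (adj G w u ≟ᵇ true))

  -- S grows by one vertex per step and never exceeds n vertices, so the fuel k cannot run out.
  explore : ∀ {v} k S → n ≤ length S + k → Explored v S → ∃ (ComponentList G v)
  explore {v} k S bound ex with leavingEdge? S
  ... | no none = S , unique ex , λ u → mk⇔ (reachable ex) complete
    where
    complete : ∀ {u} → Reach G v u → u ∈ S
    complete here = root∈ ex
    complete {u} (step {v = w} p a) with u ∈? S
    ... | yes u∈ = u∈
    ... | no u∉ = contradiction (w , u , complete p , u∉ , a) none
  ... | yes (w , u , w∈ , u∉ , a) with k
  ...   | zero = contradiction (≤-trans (length-unique≤ (∉⇒unique u∉ (unique ex))) (subst (n ≤_) (+-identityʳ _) bound)) 1+n≰n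
  ...   | suc k = explore k (u ∷ S) (subst (n ≤_) (+-suc _ k) bound) record
    { unique = ∉⇒unique u∉ (unique ex)
    ; root∈ = there (root∈ ex)
    ; reachable = λ { (here refl) → step (reachable ex w∈) a ; (there u′∈) → reachable ex u′∈ } }

  componentList : ∀ v → ∃ (ComponentList G v)
  componentList v = explore n (v ∷ []) (n≤1+n n) record
    { unique = ∉⇒unique (λ ()) [] ; root∈ = here refl ; reachable = λ { (here refl) → here } }

  component : Fin n → List (Fin n)
  component v = proj₁ (componentList v)

  unique-component : ∀ v → Unique (component v)
  unique-component v = proj₁ (proj₂ (componentList v))

  ∈-component⇔ : ∀ {v u} → u ∈ component v ⇔ Reach G v u
  ∈-component⇔ {v} {u} = proj₂ (proj₂ (componentList v)) u

  reach? : ∀ v u → Dec (Reach G v u)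
  reach? v u = Dec.map ∈-component⇔ (u ∈? component v)

  private
    reaching : Fin n → List (Fin n)
    reaching u = filter (λ j → reach? j u) (allFin n)

    headOr : Fin n → List (Fin n) → Fin n
    headOr d [] = d
    headOr d (x ∷ _) = x

  root : Fin n → Fin n
  root u = headOr u (reaching u)

  root-reaches : ∀ u → Reach G (root u) u
  root-reaches u = headOr-reaches (reaching u) (∈-filter-allFin⁻ (λ j → reach? j u))
    where
    headOr-reaches : ∀ js → (∀ {j} → j ∈ js → Reach G j u) → Reach G (headOr u js) u
    headOr-reaches [] _ = here
    headOr-reaches (j ∷ js) reaches = reaches (here refl)

  root-cong : ∀ {u v} → Reach G u v → root u ≡ root v
  root-cong {u} {v} p = trans (cong (headOr u) same) (headOr-∈ (∈-filter-allFin⁺ (λ j → reach? j v) here))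
    where
    same : reaching u ≡ reaching v
    same = filter-≐ (λ j → reach? j u) (λ j → reach? j v) ((_◅◅ p) , (_◅◅ reverse p)) (allFin n)
    headOr-∈ : ∀ {js x} → x ∈ js → headOr u js ≡ headOr v js
    headOr-∈ (here _) = refl
    headOr-∈ (there _) = refl

  roots : List (Fin n)
  roots = filter (λ r → root r ≟ r) (allFin n)

  components↭ : concatMap component roots ↭ allFin n
  components↭ = ↭-allFin (unique-concatMap (unique-filter-allFin (λ r → root r ≟ r)) unique-component same) covers
    where
    isRoot = ∈-filter-allFin⁻ (λ r → root r ≟ r)
    same : ∀ {r r′ u} → r ∈ roots → r′ ∈ roots → u ∈ component r → u ∈ component r′ → r ≡ r′
    same r∈ r′∈ u∈ u∈′ =
      trans (sym (isRoot r∈))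
            (trans (root-cong (Equivalence.to ∈-component⇔ u∈ ◅◅ reverse (Equivalence.to ∈-component⇔ u∈′))) (isRoot r′∈))
    covers : ∀ u → u ∈ concatMap component roots
    covers u = ∈-concatMap⁺ component (lose (∈-filter-allFin⁺ (λ r → root r ≟ r) (root-cong (root-reaches u)))
                                            (Equivalence.from ∈-component⇔ (root-reaches u)))

  private
    walkColour : ∀ {r u} → Dec (Reach G r u) → Bool
    walkColour (yes p) = parity p
    walkColour (no _) = false

    colouredWalk′ : ∀ {r u} (d : Dec (Reach G r u)) → Reach G r u → Σ (Reach G r u) λ p → parity p ≡ walkColour d
    colouredWalk′ (yes p) _ = p , refl
    colouredWalk′ (no ¬p) p = contradiction p ¬p

  colour : Fin n → Fin n → Bool
  colour r u = walkColour (reach? r u)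

  colouredWalk : ∀ {r u} → Reach G r u → Σ (Reach G r u) λ p → parity p ≡ colour r u
  colouredWalk = colouredWalk′ (reach? _ _)

  OddEdge : Fin n → Set
  OddEdge r = ∃₂ λ u v → Reach G r u × Reach G r v × Adj G u v × colour r u ≡ colour r v

  oddEdge? : ∀ r → Dec (OddEdge r)
  oddEdge? r = Dec.map′ (λ (u , v , p) → u , v , p) (λ (u , v , p) → u , v , p)
    (any? λ u → any? λ v → reach? r u ×-dec reach? r v ×-dec adj G u v ≟ᵇ true ×-dec colour r u ≟ᵇ colour r v)

  ¬oddEdge⇒proper : ∀ {r} → ¬ OddEdge r → Proper2ColouringOn G (component r) (colour r)
  ¬oddEdge⇒proper none u w u∈ w∈ a same =
    none (u , w , Equivalence.to ∈-component⇔ u∈ , Equivalence.to ∈-component⇔ w∈ , a , same)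

  private
    another : ∀ {x : Fin n} {xs} → Unique xs → x ∈ xs → 4 ∣ length xs → ∃ λ y → y ∈ xs × y ≢ x
    another {xs = _ ∷ []} _ _ 4∣1 = contradiction (∣1⇒≡1 4∣1) λ ()
    another {x} {xs = y ∷ z ∷ _} u _ _ with y ≟ x
    ... | no y≢x = y , here refl , y≢x
    ... | yes refl = z , there (here refl) , ≢-sym (∈∉⇒≢ (here refl) (unique⇒∉ u))

  bothColours : ∀ {r} → Proper2ColouringOn G (component r) (colour r) → 4 ∣ length (component r) →
                ∃₂ λ t f → (t ∈ component r × colour r t ≡ true) × (f ∈ component r × colour r f ≡ false)
  bothColours {r} proper 4∣ with another (unique-component r) (Equivalence.from ∈-component⇔ here) 4∣
  ... | u , u∈ , u≢r with lastEdge (Equivalence.to ∈-component⇔ u∈) u≢r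
  ... | v , pv , a = pick (colour r u) refl (colour r v) refl (proper v u v∈ u∈ a)
    where
    v∈ = Equivalence.from ∈-component⇔ pv
    pick : ∀ cu → colour r u ≡ cu → ∀ cv → colour r v ≡ cv → cv ≢ cu →
           ∃₂ λ t f → (t ∈ component r × colour r t ≡ true) × (f ∈ component r × colour r f ≡ false)
    pick true eu false ev _ = u , v , (u∈ , eu) , (v∈ , ev)
    pick false eu true ev _ = v , u , (v∈ , ev) , (u∈ , eu)
    pick true _ true _ differ = contradiction refl differ
    pick false _ false _ differ = contradiction refl differ


module Labelings {n : ℕ} (G : Graph n) {C : Set} {op : C → C → C} {e : C} {inv : C → C}
                 (isAbelianGroup : IsAbelianGroup _≡_ op e inv) where

  open GroupSums isAbelianGroup
  open Walks G
  open Components G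
  open ≡-Reasoning
  open import Algebra.Solver.CommutativeMonoid commutativeMonoid using (solve; _⊜_; _⊕_)

  when : Bool → C → C
  when b g = if b then g else ε

  wd : Labeling Γ G → Fin n → C
  wd (f , _) = weightedDegree Γ G f

  weightedDegree≡∑ : ∀ f x → weightedDegree Γ G f x ≡ ∑ (allFin n) (λ u → when (adj G x u) (f u x))
  weightedDegree≡∑ f x = go (allFin n)
    where
    go : ∀ us → foldr (λ u acc → if adj G x u then f u x ∙ acc else acc) ε us ≡ ∑ us (λ u → when (adj G x u) (f u x))
    go [] = refl
    go (u ∷ us) with adj G x u
    ... | true = cong (f u x ∙_) (go us)
    ... | false = trans (go us) (sym (identityˡ _))

  0ᴸ : Labeling Γ G
  0ᴸ = (λ _ _ → ε) , λ _ _ → refl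

  infixl 6 _+ᴸ_
  _+ᴸ_ : Labeling Γ G → Labeling Γ G → Labeling Γ G
  (f , f-sym) +ᴸ (h , h-sym) = (λ u v → f u v ∙ h u v) , λ u v → cong₂ _∙_ (f-sym u v) (h-sym u v)

  when-ε : ∀ b → when b ε ≡ ε
  when-ε true = refl
  when-ε false = refl

  when-∙ : ∀ b g h → when b (g ∙ h) ≡ when b g ∙ when b h
  when-∙ true g h = refl
  when-∙ false g h = sym (identityˡ ε)

  wd-0ᴸ : ∀ x → wd 0ᴸ x ≡ ε
  wd-0ᴸ x = trans (weightedDegree≡∑ _ x) (∑-ε (allFin n) λ u → when-ε (adj G x u))

  weightedDegree-∙ : ∀ f h x → weightedDegree Γ G (λ u v → f u v ∙ h u v) x ≡ weightedDegree Γ G f x ∙ weightedDegree Γ G h x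
  weightedDegree-∙ f h x = begin
    weightedDegree Γ G (λ u v → f u v ∙ h u v) x
      ≡⟨ weightedDegree≡∑ (λ u v → f u v ∙ h u v) x ⟩
    ∑ (allFin n) (λ u → when (adj G x u) (f u x ∙ h u x))
      ≡⟨ ∑-cong (allFin n) (λ u → when-∙ (adj G x u) (f u x) (h u x)) ⟩
    ∑ (allFin n) (λ u → when (adj G x u) (f u x) ∙ when (adj G x u) (h u x))
      ≡⟨ ∑-∙ (allFin n) _ _ ⟩
    ∑ (allFin n) (λ u → when (adj G x u) (f u x)) ∙ ∑ (allFin n) (λ u → when (adj G x u) (h u x))
      ≡⟨ cong₂ _∙_ (weightedDegree≡∑ f x) (weightedDegree≡∑ h x) ⟨
    weightedDegree Γ G f x ∙ weightedDegree Γ G h x ∎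

  wd-+ᴸ : ∀ F H x → wd (F +ᴸ H) x ≡ wd F x ∙ wd H x
  wd-+ᴸ (f , _) (h , _) = weightedDegree-∙ f h

  weightedDegree-point : ∀ a (φ : Fin n → C) x → weightedDegree Γ G (λ u v → (a ↦ φ v) u) x ≡ when (adj G x a) (φ x)
  weightedDegree-point a φ x = begin
    weightedDegree Γ G (λ u v → (a ↦ φ v) u) x         ≡⟨ weightedDegree≡∑ (λ u v → (a ↦ φ v) u) x ⟩
    ∑ (allFin n) (λ u → when (adj G x u) ((a ↦ φ x) u)) ≡⟨ ∑-cong (allFin n) when-↦ ⟩
    ∑ (allFin n) (a ↦ when (adj G x a) (φ x))           ≡⟨ ∑-point (when (adj G x a) (φ x)) (allFin n) (Unique.allFin⁺ n) (∈-allFin a) ⟩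
    when (adj G x a) (φ x)                              ∎
    where
    when-↦ : ∀ u → when (adj G x u) ((a ↦ φ x) u) ≡ (a ↦ when (adj G x a) (φ x)) u
    when-↦ u with a ≟ u
    ... | yes refl = refl
    ... | no _ = when-ε (adj G x u)

  edgeLabeling : Fin n → Fin n → C → Labeling Γ G
  edgeLabeling a b g = f , λ u v → trans (cong₂ _∙_ (↦-swap a b g u v) (↦-swap b a g u v)) (comm _ _)
    where
    f : Fin n → Fin n → C
    f u v = (a ↦ (b ↦ g) v) u ∙ (b ↦ (a ↦ g) v) u

  wd-edgeLabeling : ∀ {a b} g → Adj G a b → ∀ x → wd (edgeLabeling a b g) x ≡ (a ↦ g) x ∙ (b ↦ g) x
  wd-edgeLabeling {a} {b} g ab x = begin
    wd (edgeLabeling a b g) x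
      ≡⟨ weightedDegree-∙ (λ u v → (a ↦ (b ↦ g) v) u) (λ u v → (b ↦ (a ↦ g) v) u) x ⟩
    weightedDegree Γ G (λ u v → (a ↦ (b ↦ g) v) u) x ∙ weightedDegree Γ G (λ u v → (b ↦ (a ↦ g) v) u) x
      ≡⟨ cong₂ _∙_ (weightedDegree-point a (b ↦ g) x) (weightedDegree-point b (a ↦ g) x) ⟩
    when (adj G x a) ((b ↦ g) x) ∙ when (adj G x b) ((a ↦ g) x)
      ≡⟨ cong₂ _∙_ (at-neighbour ab) (at-neighbour (adj-sym ab)) ⟩
    (b ↦ g) x ∙ (a ↦ g) x
      ≡⟨ comm _ _ ⟩
    (a ↦ g) x ∙ (b ↦ g) x ∎
    where
    at-neighbour : ∀ {a b} → Adj G a b → when (adj G x a) ((b ↦ g) x) ≡ (b ↦ g) x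
    at-neighbour {a} {b} ab with b ≟ x
    ... | yes refl rewrite adj-sym ab = refl
    ... | no _ = when-ε (adj G x a)

  walkLabeling : ∀ {r u} → Reach G r u → C → Labeling Γ G
  walkLabeling here g = 0ᴸ
  walkLabeling (step {v = v} {w = w} p _) g = walkLabeling p (g ⁻¹) +ᴸ edgeLabeling v w g

  -- The labels alternate g, g ⁻¹, g, … backwards along the walk, so they cancel at every inner vertex.
  wd-walkLabeling : ∀ {r u} (p : Reach G r u) g x → wd (walkLabeling p g) x ≡ (u ↦ g) x ∙ (r ↦ signed (parity p) g) x
  wd-walkLabeling {r} here g x = trans (wd-0ᴸ x) (sym (↦-inverseʳ r g x))
  wd-walkLabeling {r} (step {v = v} {w = w} p a) g x = begin
    wd (walkLabeling p (g ⁻¹) +ᴸ edgeLabeling v w g) x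
      ≡⟨ wd-+ᴸ (walkLabeling p (g ⁻¹)) (edgeLabeling v w g) x ⟩
    wd (walkLabeling p (g ⁻¹)) x ∙ wd (edgeLabeling v w g) x
      ≡⟨ cong₂ _∙_ (wd-walkLabeling p (g ⁻¹) x) (wd-edgeLabeling g a x) ⟩
    ((v ↦ g ⁻¹) x ∙ (r ↦ signed (parity p) (g ⁻¹)) x) ∙ ((v ↦ g) x ∙ (w ↦ g) x)
      ≡⟨ solve 4 (λ A B C D → (A ⊕ B) ⊕ (C ⊕ D) ⊜ (D ⊕ B) ⊕ (A ⊕ C)) refl _ _ _ _ ⟩
    ((w ↦ g) x ∙ (r ↦ signed (parity p) (g ⁻¹)) x) ∙ ((v ↦ g ⁻¹) x ∙ (v ↦ g) x)
      ≡⟨ cong₂ _∙_ (cong (λ h → (w ↦ g) x ∙ (r ↦ h) x) (sym (signed-not (parity p) g))) (↦-inverseˡ v g x) ⟩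
    ((w ↦ g) x ∙ (r ↦ signed (not (parity p)) g) x) ∙ ε
      ≡⟨ identityʳ _ ⟩
    (w ↦ g) x ∙ (r ↦ signed (not (parity p)) g) x ∎

  -- Closing the two walks with the edge uv gives a closed walk of odd length through r.
  oddCycleLabeling : ∀ {r u v} → Reach G r u → Reach G r v → Adj G u v → C → Labeling Γ G
  oddCycleLabeling {u = u} {v} p q _ h = edgeLabeling u v g +ᴸ (walkLabeling p (g ⁻¹) +ᴸ walkLabeling q (g ⁻¹))
    where g = signed (parity p) h ⁻¹

  wd-oddCycleLabeling : ∀ {r u v} (p : Reach G r u) (q : Reach G r v) (a : Adj G u v) → parity p ≡ parity q →
                        ∀ h x → wd (oddCycleLabeling p q a h) x ≡ (r ↦ h ∙ h) x
  wd-oddCycleLabeling {r} {u} {v} p q a same h x = begin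
    wd (edgeLabeling u v g +ᴸ (walkLabeling p (g ⁻¹) +ᴸ walkLabeling q (g ⁻¹))) x
      ≡⟨ trans (wd-+ᴸ (edgeLabeling u v g) (walkLabeling p (g ⁻¹) +ᴸ walkLabeling q (g ⁻¹)) x)
               (cong (wd (edgeLabeling u v g) x ∙_) (wd-+ᴸ (walkLabeling p (g ⁻¹)) (walkLabeling q (g ⁻¹)) x)) ⟩
    wd (edgeLabeling u v g) x ∙ (wd (walkLabeling p (g ⁻¹)) x ∙ wd (walkLabeling q (g ⁻¹)) x)
      ≡⟨ cong₂ _∙_ (wd-edgeLabeling g a x) (cong₂ _∙_ (wd-walkLabeling p (g ⁻¹) x) (wd-walkLabeling q (g ⁻¹) x)) ⟩
    ((u ↦ g) x ∙ (v ↦ g) x) ∙ (((u ↦ g ⁻¹) x ∙ (r ↦ signed (parity p) (g ⁻¹)) x) ∙ ((v ↦ g ⁻¹) x ∙ (r ↦ signed (parity q) (g ⁻¹)) x))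
      ≡⟨ cong (λ c → ((u ↦ g) x ∙ (v ↦ g) x) ∙ (((u ↦ g ⁻¹) x ∙ (r ↦ H) x) ∙ ((v ↦ g ⁻¹) x ∙ (r ↦ signed c (g ⁻¹)) x))) (sym same) ⟩
    ((u ↦ g) x ∙ (v ↦ g) x) ∙ (((u ↦ g ⁻¹) x ∙ (r ↦ H) x) ∙ ((v ↦ g ⁻¹) x ∙ (r ↦ H) x))
      ≡⟨ solve 5 (λ A B C D E → (A ⊕ B) ⊕ ((C ⊕ D) ⊕ (E ⊕ D)) ⊜ ((C ⊕ A) ⊕ (E ⊕ B)) ⊕ (D ⊕ D)) refl _ _ _ _ _ ⟩
    (((u ↦ g ⁻¹) x ∙ (u ↦ g) x) ∙ ((v ↦ g ⁻¹) x ∙ (v ↦ g) x)) ∙ ((r ↦ H) x ∙ (r ↦ H) x)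
      ≡⟨ cong₂ _∙_ (trans (cong₂ _∙_ (↦-inverseˡ u g x) (↦-inverseˡ v g x)) (identityˡ ε)) (↦-∙ r H H x) ⟩
    ε ∙ (r ↦ H ∙ H) x
      ≡⟨ trans (identityˡ _) (cong (λ k → (r ↦ k ∙ k) x) H≡h) ⟩
    (r ↦ h ∙ h) x ∎
    where
    g = signed (parity p) h ⁻¹
    H = signed (parity p) (g ⁻¹)
    H≡h : H ≡ h
    H≡h = trans (cong (signed (parity p)) (⁻¹-involutive _)) (signed-involutive (parity p) h)

  Realizes : Labeling Γ G → List (Fin n × C) → Set
  Realizes F E = ∀ x → wd F x ≡ target E x

  signedSum : Fin n → List (Fin n × C) → C
  signedSum r E = ∑ E (λ (u , g) → signed (colour r u) g)

  InComponent : Fin n → List (Fin n × C) → Set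
  InComponent r E = All (λ (u , _) → Reach G r u) E

  walkLabelings : ∀ {r} E → InComponent r E → Labeling Γ G
  walkLabelings [] [] = 0ᴸ
  walkLabelings ((u , g) ∷ E) (p ∷ ps) = walkLabeling (proj₁ (colouredWalk p)) g +ᴸ walkLabelings E ps

  wd-walkLabelings : ∀ {r} E (ps : InComponent r E) x → wd (walkLabelings E ps) x ≡ target E x ∙ (r ↦ signedSum r E) x
  wd-walkLabelings {r} [] [] x = trans (wd-0ᴸ x) (sym (trans (identityˡ _) (↦-ε r x)))
  wd-walkLabelings {r} ((u , g) ∷ E) (p ∷ ps) x = begin
    wd (walkLabeling p′ g +ᴸ walkLabelings E ps) x
      ≡⟨ wd-+ᴸ (walkLabeling p′ g) (walkLabelings E ps) x ⟩
    wd (walkLabeling p′ g) x ∙ wd (walkLabelings E ps) x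
      ≡⟨ cong₂ _∙_ (wd-walkLabeling p′ g x) (wd-walkLabelings E ps x) ⟩
    ((u ↦ g) x ∙ (r ↦ signed (parity p′) g) x) ∙ (target E x ∙ (r ↦ signedSum r E) x)
      ≡⟨ interchange _ _ _ _ ⟩
    ((u ↦ g) x ∙ target E x) ∙ ((r ↦ signed (parity p′) g) x ∙ (r ↦ signedSum r E) x)
      ≡⟨ cong ((u ↦ g) x ∙ target E x ∙_) (trans (↦-∙ r _ _ x) (cong (λ c → (r ↦ signed c g ∙ signedSum r E) x) (proj₂ (colouredWalk p)))) ⟩
    ((u ↦ g) x ∙ target E x) ∙ (r ↦ signedSum r ((u , g) ∷ E)) x ∎
    where p′ = proj₁ (colouredWalk p)

  rootCorrection : ∀ {r} S → S ≡ ε ⊎ (OddEdge r × IsDouble S) → Σ (Labeling Γ G) λ F → ∀ x → wd F x ≡ (r ↦ S ⁻¹) x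
  rootCorrection {r} S (inj₁ refl) = 0ᴸ , λ x → trans (wd-0ᴸ x) (sym (trans (cong (λ h → (r ↦ h) x) ε⁻¹≈ε) (↦-ε r x)))
  rootCorrection {r} S (inj₂ ((u , v , pu , pv , a , same) , k , S≡k²)) =
    oddCycleLabeling p q a (k ⁻¹) , λ x → trans (wd-oddCycleLabeling p q a parity≡ (k ⁻¹) x)
                                              (cong (λ h → (r ↦ h) x) (trans (⁻¹-∙-comm k k) (cong _⁻¹ (sym S≡k²))))
    where
    p = proj₁ (colouredWalk pu)
    q = proj₁ (colouredWalk pv)
    parity≡ : parity p ≡ parity q
    parity≡ = trans (proj₂ (colouredWalk pu)) (trans same (sym (proj₂ (colouredWalk pv))))

  realize : ∀ {r} E → InComponent r E → signedSum r E ≡ ε ⊎ (OddEdge r × IsDouble (signedSum r E)) →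
            Σ (Labeling Γ G) λ F → Realizes F E
  realize {r} E ps cancellable = walkLabelings E ps +ᴸ proj₁ correction , λ x → begin
    wd (walkLabelings E ps +ᴸ proj₁ correction) x
      ≡⟨ wd-+ᴸ (walkLabelings E ps) (proj₁ correction) x ⟩
    wd (walkLabelings E ps) x ∙ wd (proj₁ correction) x
      ≡⟨ cong₂ _∙_ (wd-walkLabelings E ps x) (proj₂ correction x) ⟩
    (target E x ∙ (r ↦ signedSum r E) x) ∙ (r ↦ signedSum r E ⁻¹) x
      ≡⟨ assoc _ _ _ ⟩
    target E x ∙ ((r ↦ signedSum r E) x ∙ (r ↦ signedSum r E ⁻¹) x)
      ≡⟨ cong (target E x ∙_) (↦-inverseʳ r _ x) ⟩
    target E x ∙ ε
      ≡⟨ identityʳ _ ⟩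
    target E x ∎
    where correction = rootCorrection (signedSum r E) cancellable

  quadEntries : Quad (Fin n) → Quad C → List (Fin n × C)
  quadEntries V Q = zip (flattenQuads (V ∷ [])) (flattenQuads (Q ∷ []))

  Accepts : (Quad C → Set) → Quad (Fin n) → Set
  Accepts P V = ∀ Q → P Q → Σ (Labeling Γ G) λ F → Realizes F (quadEntries V Q)

  Within : Fin n → Quad (Fin n) → Set
  Within r V = All (Reach G r) (flattenQuads (V ∷ []))

  private
    within⇒inComponent : ∀ {r} V Q → Within r V → InComponent r (quadEntries V Q)
    within⇒inComponent _ _ (pa ∷ pb ∷ pc ∷ pd ∷ []) = pa ∷ pb ∷ pc ∷ pd ∷ []

  oddComponent-accepts : ∀ {r V} → OddEdge r → Within r V → Accepts Balanced V
  oddComponent-accepts {r} {V@((a , b) , (c , d))} odd within Q balanced =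
    realize (quadEntries V Q) (within⇒inComponent V Q within)
      (inj₂ (odd , signed-quad-double {colour r a} {colour r b} {colour r c} {colour r d} balanced))

  split-accepts : ∀ {r V} → Within r V → Split (colour r) V → Accepts Balanced V
  split-accepts {V = V} within ((mono₁ , mono₂) , differ) Q balanced =
    realize (quadEntries V Q) (within⇒inComponent V Q within) (inj₁ (signed-quad-cancel mono₁ mono₂ balanced (inj₁ differ)))

  monochromatic-accepts : ∀ {r V} → Within r V → Monochromatic (colour r) V → Accepts StronglyBalanced V
  monochromatic-accepts {V = V} within (mono₁ , mono₂) Q (balanced , order2) =
    realize (quadEntries V Q) (within⇒inComponent V Q within) (inj₁ (signed-quad-cancel mono₁ mono₂ balanced (inj₂ order2)))

  accepts-weaken : ∀ {V} → Accepts Balanced V → Accepts StronglyBalanced V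
  accepts-weaken acc Q (balanced , _) = acc Q balanced

  quadsWithin : ∀ {r} qs → flattenQuads qs ↭ component r → All (Within r) qs
  quadsWithin qs flat↭ = All-flattenQuads qs (All.tabulate λ u∈ → Equivalence.to ∈-component⇔ (∈-resp-↭ flat↭ u∈))

  AcceptableQuads : List (Fin n) → Set
  AcceptableQuads L = ∃ λ qs → HeadAll (Accepts Balanced) (Accepts StronglyBalanced) qs × flattenQuads qs ↭ L

  oddComponentQuads : ∀ {r} → OddEdge r → 4 ∣ length (component r) → AcceptableQuads (component r)
  oddComponentQuads {r} odd 4∣ =
    quadsOf (component r) ,
    All⇒HeadAll (λ acc → acc) (λ {V} → accepts-weaken {V})
                (All.map (λ {V} → oddComponent-accepts {V = V} odd) (quadsWithin (quadsOf (component r)) flat↭)) ,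
    flat↭
    where flat↭ = ↭-reflexive (flattenQuads-quadsOf (component r) 4∣)

  bipartiteComponentQuads : ∀ {r} → ¬ OddEdge r → 4 ∣ length (component r) →
                            2 ∣ length (filterᵇ (colour r) (component r)) →
                            2 ∣ length (filterᵇ (not ∘ colour r) (component r)) →
                            AcceptableQuads (component r)
  bipartiteComponentQuads {r} ¬odd 4∣ 2∣A 2∣B with bothColours (¬oddEdge⇒proper ¬odd) 4∣
  ... | t , f , (t∈ , ct) , (f∈ , cf) with bipartiteQuads (colour r) (component r) 4∣ 2∣A 2∣B t∈ ct f∈ cf
  ... | qs , colouring , flat↭ =
    qs , HeadAll-map (λ {V} → split-accepts {V = V}) (λ {V} → monochromatic-accepts {V = V}) (quadsWithin qs flat↭) colouring ,
    flat↭

  componentQuads : ComponentHyp G → ∀ r → AcceptableQuads (component r)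
  componentQuads hyp r with hyp r (component r) (unique-component r , λ u → ∈-component⇔) | oddEdge? r
  ... | 4∣ , _ | yes odd = oddComponentQuads odd 4∣
  ... | 4∣ , evenClasses | no ¬odd =
    let 2∣A , 2∣B = evenClasses (colour r) (¬oddEdge⇒proper ¬odd) in bipartiteComponentQuads ¬odd 4∣ 2∣A 2∣B

  componentsQuads : ComponentHyp G → ∀ rs → AcceptableQuads (concatMap component rs)
  componentsQuads hyp [] = [] , _ , ↭-refl
  componentsQuads hyp (r ∷ rs) with componentQuads hyp r | componentsQuads hyp rs
  ... | qs , accepting , flat↭ | qs′ , accepting′ , flat↭′ =
    qs ++ qs′ , HeadAll-++ (λ {V} → accepts-weaken {V}) qs qs′ accepting accepting′ ,
    subst (_↭ concatMap component (r ∷ rs)) (sym (flattenQuads-++ qs qs′)) (++⁺ flat↭ flat↭′)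

  vertexQuads : ComponentHyp G → AcceptableQuads (allFin n)
  vertexQuads hyp =
    let qs , accepting , flat↭ = componentsQuads hyp roots in qs , accepting , ↭-trans flat↭ components↭

  realizeQuads : ∀ Vs Qs → HeadAll (Accepts Balanced) (Accepts StronglyBalanced) Vs → HeadAll Balanced StronglyBalanced Qs →
                 Σ (Labeling Γ G) λ F → Realizes F (zip (flattenQuads Vs) (flattenQuads Qs))
  realizeQuads [] Qs _ _ = 0ᴸ , wd-0ᴸ
  realizeQuads (V ∷ Vs) [] _ _ = 0ᴸ , wd-0ᴸ
  realizeQuads (V ∷ Vs) (Q ∷ Qs) (acceptsV , acceptsVs) (balancedQ , balancedQs) =
    combine V Q {Vs} {Qs} (acceptsV Q balancedQ) (realizeAll Vs Qs acceptsVs balancedQs)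
    where
    combine : ∀ V Q {Vs Qs} → Σ (Labeling Γ G) (λ F → Realizes F (quadEntries V Q)) →
              Σ (Labeling Γ G) (λ F → Realizes F (zip (flattenQuads Vs) (flattenQuads Qs))) →
              Σ (Labeling Γ G) λ F → Realizes F (zip (flattenQuads (V ∷ Vs)) (flattenQuads (Q ∷ Qs)))
    combine V Q {Vs} {Qs} (F , F-realizes) (H , H-realizes) = F +ᴸ H , λ x →
      trans (wd-+ᴸ F H x) (trans (cong₂ _∙_ (F-realizes x) (H-realizes x))
                                 (sym (∑-++ (quadEntries V Q) (zip (flattenQuads Vs) (flattenQuads Qs)) _)))
    realizeAll : ∀ Vs Qs → All (Accepts StronglyBalanced) Vs → All StronglyBalanced Qs →
                 Σ (Labeling Γ G) λ F → Realizes F (zip (flattenQuads Vs) (flattenQuads Qs))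
    realizeAll [] Qs _ _ = 0ᴸ , wd-0ᴸ
    realizeAll (V ∷ Vs) [] _ _ = 0ᴸ , wd-0ᴸ
    realizeAll (V ∷ Vs) (Q ∷ Qs) (acceptsV ∷ acceptsVs) (sbQ ∷ sbQs) =
      combine V Q {Vs} {Qs} (acceptsV Q sbQ) (realizeAll Vs Qs acceptsVs sbQs)


module _ {n : ℕ} (G : Graph n) (hyp : ComponentHyp G)
         {op : Fin n → Fin n → Fin n} {e : Fin n} {inv : Fin n → Fin n}
         (isAbelianGroup : IsAbelianGroup _≡_ op e inv) where

  open GroupSums isAbelianGroup
  open Labelings G isAbelianGroup
  open GroupQuads isAbelianGroup using (groupQuads)

  private
    4∣n : ∀ {Vs} → flattenQuads Vs ↭ allFin n → 4 ∣ n
    4∣n {Vs} Vs↭ = divides (length Vs) (begin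
      n                         ≡⟨ length-allFin ⟨
      length (allFin n)         ≡⟨ ↭-length Vs↭ ⟨
      length (flattenQuads Vs)  ≡⟨ length-flattenQuads Vs ⟩
      4 * length Vs             ≡⟨ *-comm 4 (length Vs) ⟩
      length Vs * 4             ∎)
      where open ≡-Reasoning

    irregular : ∀ {Vs Qs} F → flattenQuads Vs ↭ allFin n → flattenQuads Qs ↭ allFin n →
                Realizes F (zip (flattenQuads Vs) (flattenQuads Qs)) → Irregular Γ G F
    irregular {Vs} {Qs} F Vs↭ Qs↭ realizes u v wu≡wv =
      target-zip-injective (flattenQuads Vs) (flattenQuads Qs) (enumerates Vs↭) (enumerates Qs↭)
        (trans (↭-length Vs↭) (sym (↭-length Qs↭))) (∈-resp-↭ (↭-sym Vs↭) (∈-allFin u)) (∈-resp-↭ (↭-sym Vs↭) (∈-allFin v))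
        (trans (sym (realizes u)) (trans wu≡wv (realizes v)))
      where enumerates = λ {xs} xs↭ → unique-resp-↭ {xs = allFin n} {ys = xs} (↭-sym xs↭) (Unique.allFin⁺ n)

  irregularLabeling : Σ (Labeling Γ G) (Irregular Γ G)
  irregularLabeling =
    let Vs , accepting , Vs↭ = vertexQuads hyp
        Qs , balanced , Qs↭ = groupQuads (4∣n Vs↭)
        F , realizes = realizeQuads Vs Qs accepting balanced
    in F , irregular F Vs↭ Qs↭ realizes

module Transport (A : AbelianGroup 0ℓ 0ℓ) {m : ℕ} (order : HasOrder A m) where

  open AbelianGroup A using (_≈_; _∙_; ε; _⁻¹; ∙-congˡ)
    renaming (Carrier to X; sym to ≈-sym; trans to ≈-trans; reflexive to ≈-reflexive)

  embed : Fin m → X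
  embed = proj₁ order

  embed-injective : ∀ {i j} → embed i ≈ embed j → i ≡ j
  embed-injective = proj₁ (proj₂ order) _ _

  index : X → Fin m
  index x = proj₁ (proj₂ (proj₂ order) x)

  embed-index : ∀ x → embed (index x) ≈ x
  embed-index x = proj₂ (proj₂ (proj₂ order) x)

  indexGroup : RawGroup 0ℓ 0ℓ
  indexGroup = record
    { Carrier = Fin m ; _≈_ = _≡_
    ; _∙_ = λ i j → index (embed i ∙ embed j) ; ε = index ε ; _⁻¹ = λ i → index (embed i ⁻¹) }

  embed-isMonomorphism : IsGroupMonomorphism indexGroup (AbelianGroup.rawGroup A) embed
  embed-isMonomorphism = record
    { isGroupHomomorphism = record
      { isMonoidHomomorphism = record
        { isMagmaHomomorphism = record
          { isRelHomomorphism = record { cong = ≈-reflexive ∘ cong embed }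
          ; homo = λ i j → embed-index _ }
        ; ε-homo = embed-index ε }
      ; ⁻¹-homo = λ i → embed-index _ }
    ; injective = embed-injective }

  isAbelianGroup : IsAbelianGroup _≡_ (RawGroup._∙_ indexGroup) (RawGroup.ε indexGroup) (RawGroup._⁻¹ indexGroup)
  isAbelianGroup = GroupMonomorphism.isAbelianGroup embed-isMonomorphism (AbelianGroup.isAbelianGroup A)

  weightedDegree-embed : ∀ {n} (G : Graph n) f x →
    weightedDegree A G (λ u v → embed (f u v)) x ≈ embed (weightedDegree (GroupSums.Γ isAbelianGroup) G f x)
  weightedDegree-embed {n} G f x = go (allFin n)
    where
    Γ = GroupSums.Γ isAbelianGroup
    go : ∀ us → foldr (λ u acc → if adj G x u then embed (f u x) ∙ acc else acc) ε us
              ≈ embed (foldr (λ u acc → if adj G x u then AbelianGroup._∙_ Γ (f u x) acc else acc) (AbelianGroup.ε Γ) us)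
    go [] = ≈-sym (embed-index ε)
    go (u ∷ us) with adj G x u
    ... | true = ≈-trans (∙-congˡ (go us)) (≈-sym (embed-index _))
    ... | false = go us

  irregular-embed : ∀ {n} {G : Graph n} → Σ (Labeling (GroupSums.Γ isAbelianGroup) G) (Irregular (GroupSums.Γ isAbelianGroup) G) →
                    Σ (Labeling A G) (Irregular A G)
  irregular-embed {G = G} ((f , f-sym) , irregular) =
    ((λ u v → embed (f u v)) , λ u v → ≈-reflexive (cong embed (f-sym u v))) ,
    λ u v wu≈wv → irregular u v
      (embed-injective (≈-trans (≈-sym (weightedDegree-embed G f u)) (≈-trans wu≈wv (weightedDegree-embed G f v))))

  irregular⇒≤ : ∀ {n} {G : Graph n} (F : Labeling A G) → Irregular A G F → n ≤ m
  irregular⇒≤ {G = G} (f , _) irregular =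
    injective⇒≤ {f = λ u → index (weightedDegree A G f u)}
      λ {u} {v} eq → irregular u v (≈-trans (≈-sym (embed-index _)) (≈-trans (≈-reflexive (cong embed eq)) (embed-index _)))

module Cyclic (k : ℕ) where

  private
    m = suc k

  _≈ₘ_ : ℕ → ℕ → Set
  x ≈ₘ y = x % m ≡ y % m

  -- x + k * x = m * x, so k * x is an inverse of x.
  negate : ℕ → ℕ
  negate x = k * x

  +-inverseʳ : ∀ x → (x + negate x) ≈ₘ 0
  +-inverseʳ x = trans (cong (_% m) (*-comm m x)) (m*n%n≡0 x m)

  abelianGroup : AbelianGroup 0ℓ 0ℓ
  abelianGroup = record
    { Carrier = ℕ ; _≈_ = _≈ₘ_ ; _∙_ = _+_ ; ε = 0 ; _⁻¹ = negate
    ; isAbelianGroup = record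
      { isGroup = record
        { isMonoid = record
          { isSemigroup = record
            { isMagma = record
              { isEquivalence = record { refl = refl ; sym = sym ; trans = trans }
              ; ∙-cong = λ {x} {y} {u} {v} x≈y u≈v → begin
                  (x + u) % m           ≡⟨ %-distribˡ-+ x u m ⟩
                  (x % m + u % m) % m   ≡⟨ cong₂ (λ a b → (a + b) % m) x≈y u≈v ⟩
                  (y % m + v % m) % m   ≡⟨ %-distribˡ-+ y v m ⟨
                  (y + v) % m           ∎ }
            ; assoc = λ x y z → cong (_% m) (+-assoc x y z) }
          ; identity = (λ x → refl) , (λ x → cong (_% m) (+-identityʳ x)) }
        ; inverse = (λ x → trans (cong (_% m) (+-comm (negate x) x)) (+-inverseʳ x)) , +-inverseʳ
        ; ⁻¹-cong = λ {x} {y} x≈y → begin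
            (k * x) % m               ≡⟨ %-distribˡ-* k x m ⟩
            ((k % m) * (x % m)) % m   ≡⟨ cong (λ a → ((k % m) * a) % m) x≈y ⟩
            ((k % m) * (y % m)) % m   ≡⟨ %-distribˡ-* k y m ⟨
            (k * y) % m               ∎ }
      ; comm = λ x y → cong (_% m) (+-comm x y) } }
    where open ≡-Reasoning

  hasOrder : HasOrder abelianGroup m
  hasOrder = toℕ , injective , surjective
    where
    injective : ∀ i j → toℕ i % m ≡ toℕ j % m → i ≡ j
    injective i j eq = toℕ-injective (trans (sym (m<n⇒m%n≡m (toℕ<n i))) (trans eq (m<n⇒m%n≡m (toℕ<n j))))
    surjective : ∀ x → ∃ λ i → toℕ i % m ≡ x % m
    surjective x = fromℕ< (m%n<n x m) , trans (cong (_% m) (toℕ-fromℕ< (m%n<n x m))) (m%n%n≡m%n x m)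

theorem2p4 : (n : ℕ) (G : Graph n) → Disconnected G → ComponentHyp G →
    GroupIrregularityStrength G n
theorem2p4 zero G (() , _) hyp
theorem2p4 (suc n) G _ hyp = s≤s z≤n , good , minimal
  where
  good : GoodOrder G (suc n)
  good A order = Transport.irregular-embed A order {G = G} (irregularLabeling G hyp (Transport.isAbelianGroup A order))
  minimal : ∀ t → 1 ≤ t → GoodOrder G t → suc n ≤ t
  minimal (suc t) _ goodₜ with goodₜ (Cyclic.abelianGroup t) (Cyclic.hasOrder t)
  ... | F , irregular = Transport.irregular⇒≤ (Cyclic.abelianGroup t) (Cyclic.hasOrder t) {G = G} F irregular
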